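{- Let $H$ be a graph whose degree partition has blocks $W_1,\dots,W_t$ with $|W_i|\le 2$ for all $i$; write $W_i=\{r_i,g_i\}$ if $|W_i|=2$ and $W_i=\{p_i\}$ if $|W_i|=1$. Let $f:G\to H$ be a covering projection from a graph $G$ whose degree partition has blocks $V_1,\dots,V_t$ with $f(V_i)=W_i$ for all $i$. Suppose that either (1) $G$ is bipartite, or (2) for every doublet block $W_i$ and every edge colour $\alpha$, the vertices $r_i$ and $g_i$ are incident with the same number of semi-edges of colour $\alpha$. Define $f':V(G)\to V(H)$ by $f'(u)=p_i$ if $u\in V_i$ and $|W_i|=1$; $f'(u)=g_i$ if $u\in V_i$, $|W_i|=2$ and $f(u)=r_i$; and $f'(u)=r_i$ if $u\in V_i$, $|W_i|=2$ and $f(u)=g_i$. Then $f'$ extends to a covering projection from $G$ to $H$.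
   Context: Graphs may have coloured vertices and edges, parallel edges, directed edges, undirected and directed loops and semi-edges (one-vertex edges contributing 1 to the degree; loops contribute 2). A graph is bipartite if its vertex set splits into two edgeless parts (so it has no loops or semi-edges). Covering projection $G\to H$: colour-preserving incidence-compatible maps on vertices and edges such that the preimage of an undirected normal edge $uv$ is a perfect matching between $f^{ -1}(u)$ and $f^{ -1}(v)$; of a directed normal edge from $u$ to $v$ such a matching oriented from $f^{ -1}(u)$ to $f^{ -1}(v)$; of an undirected loop at $u$ a disjoint union of cycles spanning $f^{ -1}(u)$ (lengths 1 and 2 allowed); of a directed loop a disjoint union of directed cycles spanning $f^{ -1}(u)$; of a semi-edge at $u$ a set of semi-edges and normal edges with each vertex of $f^{ -1}(u)$ incident with exactly one of them; for disconnected graphs each component covers a component and all vertex preimages have equal size. The degree partition is the coarsest partition of vertices such that vertices in one class have the same colour and, for each class and each edge colour, the same number of edges of that colour into that class (loops twice, semi-edges once, in/out separately for directed colours); classes are blocks, a two-vertex block is a doublet. -}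

module Defs where

open import Data.Nat using (ℕ; zero; suc; _+_; _*_; _≡ᵇ_)
open import Data.Fin using (Fin; zero; suc; _≟_)
open import Data.Bool using (Bool; true; false; if_then_else_; _∧_)
open import Data.Unit using (⊤)
open import Data.Empty using (⊥)
open import Data.Product using (Σ; ∃; _×_; _,_)
open import Data.Sum using (_⊎_)
open import Relation.Binary.PropositionalEquality using (_≡_; _≢_)
open import Relation.Nullary.Decidable using (⌊_⌋)

-- Each edge has a shape: normal undirected edge, normal directed edge
-- (tail, head), undirected loop, directed loop, or semi-edge.

data Shape (V : Set) : Set where
  undir : V → V → Shape V
  dir   : V → V → Shape V
  uloop : V → Shape V
  dloop : V → Shape V
  semi  : V → Shape V

Normal : {V : Set} → Shape V → Set
Normal (undir a b) = a ≢ b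
Normal (dir a b)   = a ≢ b
Normal (uloop a)   = ⊤
Normal (dloop a)   = ⊤
Normal (semi a)    = ⊤

record Graph : Set where
  field
    nV    : ℕ
    nE    : ℕ
    vcol  : Fin nV → ℕ
    ecol  : Fin nE → ℕ
    shape : Fin nE → Shape (Fin nV)
    wf    : (e : Fin nE) → Normal (shape e)

open Graph public

sumFin : (n : ℕ) → (Fin n → ℕ) → ℕ
sumFin zero    f = 0
sumFin (suc n) f = f zero + sumFin n (λ i → f (suc i))

b2n : Bool → ℕ
b2n true  = 1
b2n false = 0

_==_ : {n : ℕ} → Fin n → Fin n → Bool
a == b = ⌊ a ≟ b ⌋

-- kinds of incidence counts: undirected, outgoing, incoming
data Kind : Set where
  U O I : Kind

-- contribution of one edge (of given shape) to the number of edges from x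
-- into the vertex set C (loops twice, semi-edges once; directed edges
-- counted separately as out- and in-edges, a directed loop once each).
into : {n : ℕ} → Kind → Fin n → (Fin n → Bool) → Shape (Fin n) → ℕ
into U x C (undir a b) = b2n ((a == x) ∧ C b) + b2n ((b == x) ∧ C a)
into U x C (uloop a)   = 2 * b2n ((a == x) ∧ C a)
into U x C (semi a)    = b2n ((a == x) ∧ C a)
into U x C (dir a b)   = 0
into U x C (dloop a)   = 0
into O x C (dir a b)   = b2n ((a == x) ∧ C b)
into O x C (dloop a)   = b2n ((a == x) ∧ C a)
into O x C (undir a b) = 0
into O x C (uloop a)   = 0
into O x C (semi a)    = 0
into I x C (dir a b)   = b2n ((b == x) ∧ C a)
into I x C (dloop a)   = b2n ((a == x) ∧ C a)
into I x C (undir a b) = 0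
into I x C (uloop a)   = 0
into I x C (semi a)    = 0

allV : {n : ℕ} → Fin n → Bool
allV _ = true

deg : (G : Graph) → Kind → Fin (nV G) → (Fin (nV G) → Bool) → ℕ → ℕ
deg G k x C α =
  sumFin (nE G) (λ e → if ecol G e ≡ᵇ α then into k x C (shape G e) else 0)

-- Degree partition.  A partition of V(G) into s classes is a map
-- p : V(G) → Fin s (class j = p⁻¹ j).

Equitable : (G : Graph) {s : ℕ} → (Fin (nV G) → Fin s) → Set
Equitable G {s} p =
  (u v : Fin (nV G)) → p u ≡ p v →
    (vcol G u ≡ vcol G v) ×
    ((j : Fin s) (α : ℕ) (k : Kind) →
       deg G k u (λ w → p w == j) α ≡ deg G k v (λ w → p w == j) α)

-- cls : V(G) → Fin t is the degree partition (blocks cls⁻¹ 0 … cls⁻¹ (t-1),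
-- all nonempty): it is equitable and coarsest among equitable partitions.
IsDegreePartition : (G : Graph) (t : ℕ) → (Fin (nV G) → Fin t) → Set
IsDegreePartition G t cls =
  ((j : Fin t) → ∃ λ u → cls u ≡ j) ×
  Equitable G cls ×
  ((s : ℕ) (p : Fin (nV G) → Fin s) → Equitable G p →
     (u v : Fin (nV G)) → p u ≡ p v → cls u ≡ cls v)

ShapeOver : {m n : ℕ} → (Fin m → Fin n) → Shape (Fin m) → Shape (Fin n) → Set
ShapeOver f (undir x y) (undir u v) = (f x ≡ u × f y ≡ v) ⊎ (f x ≡ v × f y ≡ u)
ShapeOver f (dir x y)   (dir u v)   = f x ≡ u × f y ≡ v
ShapeOver f (uloop x)   (uloop u)   = f x ≡ u
ShapeOver f (undir x y) (uloop u)   = f x ≡ u × f y ≡ u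
ShapeOver f (dloop x)   (dloop u)   = f x ≡ u
ShapeOver f (dir x y)   (dloop u)   = f x ≡ u × f y ≡ u
ShapeOver f (semi x)    (semi u)    = f x ≡ u
ShapeOver f (undir x y) (semi u)    = f x ≡ u × f y ≡ u
ShapeOver f _           _           = ⊥

fibre : (G H : Graph) → (Fin (nV G) → Fin (nV H)) → Fin (nV H) → ℕ
fibre G H fV u = sumFin (nV G) (λ x → b2n (fV x == u))

IsCovering : (G H : Graph) → (Fin (nV G) → Fin (nV H)) → (Fin (nE G) → Fin (nE H)) → Set
IsCovering G H fV fE =
  ((x : Fin (nV G)) → vcol H (fV x) ≡ vcol G x) ×
  ((e : Fin (nE G)) → ecol H (fE e) ≡ ecol G e) ×
  ((e : Fin (nE G)) → ShapeOver fV (shape G e) (shape H (fE e))) ×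
  -- local bijectivity: every vertex x has, in the preimage of each edge e
  -- of H, the same (undirected / out / in) incidence multiplicity as fV x
  -- has in e (perfect matchings, 2-regular / directed-cycle covers of loops,
  -- exactly one incident edge for semi-edges)
  ((x : Fin (nV G)) (e : Fin (nE H)) (k : Kind) →
     sumFin (nE G) (λ e' → if fE e' == e then into k x allV (shape G e') else 0)
       ≡ into k (fV x) allV (shape H e)) ×
  ((u v : Fin (nV H)) → fibre G H fV u ≡ fibre G H fV v)

-- Bipartite: two edgeless parts, so every edge is normal and crosses.

Crosses : {n : ℕ} → (Fin n → Bool) → Shape (Fin n) → Set
Crosses side (undir a b) = side a ≢ side b
Crosses side (dir a b)   = side a ≢ side b
Crosses side _           = ⊥

Bipartite : Graph → Set
Bipartite G = ∃ λ (side : Fin (nV G) → Bool) → (e : Fin (nE G)) → Crosses side (shape G e)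

isSemiAt : {n : ℕ} → Fin n → Shape (Fin n) → ℕ
isSemiAt u (semi a) = b2n (a == u)
isSemiAt u _        = 0

semiCount : (H : Graph) → Fin (nV H) → ℕ → ℕ
semiCount H u α =
  sumFin (nE H) (λ e → if ecol H e ≡ᵇ α then isSemiAt u (shape H e) else 0)

module Submission where

-- Let σ be the involution of V(H) exchanging the two vertices of every doublet, so that
-- f' = σ ∘ f.  Equitability of the degree partition of H, whose blocks have at most two
-- vertices, forces σ to preserve the number of edges of each colour and kind between any
-- two vertices, loops and semi-edges at a vertex being counted together.  So the edges of H
-- can be permuted along σ, and composing f with that permutation gives the new covering.
-- Under (2) loops and semi-edges are preserved separately.  If G is bipartite, the edges of
-- G over an undirected loop form even cycles; 2-colouring them splits the loop into two
-- halves, each behaving like a semi-edge, and the permutation is taken on these halves.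

open import Defs
open import Algebra.Properties.CommutativeSemigroup as CommSemigroupProperties using ()
open import Data.Bool using (Bool; true; false; if_then_else_; _∧_; _∨_; not; T)
open import Data.Bool.Properties using (∧-comm; ∧-idem; ∧-identityʳ; ∧-conicalˡ; ∧-conicalʳ; ∨-zeroʳ; T-≡)
open import Data.Empty using (⊥; ⊥-elim)
open import Data.Fin using (Fin; zero; suc; toℕ; _≟_; _↑ˡ_; _↑ʳ_; splitAt)
open import Data.Fin.Properties as Fin
  using (any?; pigeonhole; toℕ-injective; toℕ<n; splitAt-↑ˡ; splitAt-↑ʳ; splitAt⁻¹-↑ˡ; splitAt⁻¹-↑ʳ)
open import Data.Nat using (ℕ; zero; suc; _+_; _*_; _∸_; _≤_; _<_; z≤n; s≤s; s≤s⁻¹; _⊓_; _<ᵇ_; _≡ᵇ_)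
open import Data.Nat.Properties hiding (_≟_)
open import Data.Product using (Σ; ∃; _×_; _,_; proj₁; proj₂)
open import Data.Sum using (_⊎_; inj₁; inj₂; [_,_]′)
open import Data.Unit using (⊤; tt)
open import Function using (Equivalence)
open import Relation.Binary.Definitions using (tri<; tri≈; tri>)
open import Relation.Binary.PropositionalEquality
open import Relation.Nullary using (¬_; yes; no; Dec; contradiction)
open import Relation.Nullary.Decidable using (_×-dec_; ¬?)

module +-CS = CommSemigroupProperties +-commutativeSemigroup
module *-CS = CommSemigroupProperties *-commutativeSemigroup

==-refl : {n : ℕ} (a : Fin n) → (a == a) ≡ true
==-refl a with a ≟ a
... | yes _ = refl
... | no a≢a = ⊥-elim (a≢a refl)

==⇒≡ : {n : ℕ} {a b : Fin n} → (a == b) ≡ true → a ≡ b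
==⇒≡ {a = a} {b} eq with a ≟ b
... | yes a≡b = a≡b

≢⇒==false : {n : ℕ} {a b : Fin n} → a ≢ b → (a == b) ≡ false
≢⇒==false {a = a} {b} a≢b with a ≟ b
... | yes a≡b = ⊥-elim (a≢b a≡b)
... | no _ = refl

==false⇒≢ : {n : ℕ} {a b : Fin n} → (a == b) ≡ false → a ≢ b
==false⇒≢ {a = a} eq refl with trans (sym eq) (==-refl a)
... | ()

data ==-View {n : ℕ} (a b : Fin n) : Set where
  equal    : a ≡ b → (a == b) ≡ true  → ==-View a b
  distinct : a ≢ b → (a == b) ≡ false → ==-View a b

==-view : {n : ℕ} (a b : Fin n) → ==-View a b
==-view a b with a == b in eq
... | true  = equal (==⇒≡ eq) eq
... | false = distinct (==false⇒≢ eq) eq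

==-sym : {n : ℕ} (a b : Fin n) → (a == b) ≡ (b == a)
==-sym a b with ==-view a b
... | equal refl eq = trans eq (sym eq)
... | distinct a≢b eq = trans eq (sym (≢⇒==false (λ b≡a → a≢b (sym b≡a))))

==-injective : {m n : ℕ} (f : Fin m → Fin n) → (∀ {x y} → f x ≡ f y → x ≡ y) →
               ∀ a b → (f a == f b) ≡ (a == b)
==-injective f f-inj a b with ==-view a b
... | equal refl eq = trans (==-refl (f a)) (sym eq)
... | distinct a≢b eq = trans (≢⇒==false (λ p → a≢b (f-inj p))) (sym eq)

true⇔true⇒≡ : {a b : Bool} → (a ≡ true → b ≡ true) → (b ≡ true → a ≡ true) → a ≡ b
true⇔true⇒≡ {true}  {true}  _ _ = refl
true⇔true⇒≡ {false} {false} _ _ = refl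
true⇔true⇒≡ {true}  {false} f _ = sym (f refl)
true⇔true⇒≡ {false} {true}  _ g = g refl

∧-true : ∀ {p q} → p ∧ q ≡ true → p ≡ true × q ≡ true
∧-true {true} {true} _ = refl , refl

b2n≤1 : (b : Bool) → b2n b ≤ 1
b2n≤1 true  = s≤s z≤n
b2n≤1 false = z≤n

b2n-∧ : (a b : Bool) → b2n (a ∧ b) ≡ b2n a * b2n b
b2n-∧ true  true  = refl
b2n-∧ true  false = refl
b2n-∧ false b     = refl

b2n-∧-≤ : (a b : Bool) → b2n (a ∧ b) ≤ b2n a
b2n-∧-≤ true  b = b2n≤1 b
b2n-∧-≤ false b = z≤n

if-then-0 : (b : Bool) (x : ℕ) → (if b then x else 0) ≡ b2n b * x
if-then-0 true  x = sym (+-identityʳ x)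
if-then-0 false x = refl

if-then-0-cong : (b : Bool) {x y : ℕ} → x ≡ y → (if b then x else 0) ≡ (if b then y else 0)
if-then-0-cong b = cong (if b then_else 0)

if-then-0-+ : (b : Bool) (x y : ℕ) → (if b then x + y else 0) ≡ (if b then x else 0) + (if b then y else 0)
if-then-0-+ true  x y = refl
if-then-0-+ false x y = refl

if-then-0-* : (b : Bool) (c x : ℕ) → (if b then c * x else 0) ≡ c * (if b then x else 0)
if-then-0-* true  c x = refl
if-then-0-* false c x = sym (*-zeroʳ c)

b2n-pos : (b : Bool) (x : ℕ) → 0 < b2n b * x → b ≡ true × 0 < x
b2n-pos true x lt = refl , subst (0 <_) (+-identityʳ x) lt

sumFin-cong : (n : ℕ) {f g : Fin n → ℕ} → (∀ i → f i ≡ g i) → sumFin n f ≡ sumFin n g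
sumFin-cong zero    eq = refl
sumFin-cong (suc n) eq = cong₂ _+_ (eq zero) (sumFin-cong n (λ i → eq (suc i)))

sumFin-zero : (n : ℕ) (f : Fin n → ℕ) → (∀ i → f i ≡ 0) → sumFin n f ≡ 0
sumFin-zero zero    f eq = refl
sumFin-zero (suc n) f eq = cong₂ _+_ (eq zero) (sumFin-zero n (λ i → f (suc i)) (λ i → eq (suc i)))

sumFin-+ : (n : ℕ) (f g : Fin n → ℕ) → sumFin n (λ i → f i + g i) ≡ sumFin n f + sumFin n g
sumFin-+ zero    f g = refl
sumFin-+ (suc n) f g = trans (cong (f zero + g zero +_) (sumFin-+ n (λ i → f (suc i)) (λ i → g (suc i))))
                             (+-CS.interchange (f zero) (g zero) _ _)

sumFin-*ˡ : (n c : ℕ) (f : Fin n → ℕ) → sumFin n (λ i → c * f i) ≡ c * sumFin n f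
sumFin-*ˡ zero    c f = sym (*-zeroʳ c)
sumFin-*ˡ (suc n) c f = trans (cong (c * f zero +_) (sumFin-*ˡ n c (λ i → f (suc i))))
                              (sym (*-distribˡ-+ c (f zero) _))

sumFin-swap : (n m : ℕ) (f : Fin n → Fin m → ℕ) →
              sumFin n (λ i → sumFin m (f i)) ≡ sumFin m (λ j → sumFin n (λ i → f i j))
sumFin-swap zero    m f = sym (sumFin-zero m _ (λ _ → refl))
sumFin-swap (suc n) m f = trans (cong (sumFin m (f zero) +_) (sumFin-swap n m (λ i → f (suc i))))
                                (sym (sumFin-+ m (f zero) _))

sumFin-mono-≤ : (n : ℕ) {f g : Fin n → ℕ} → (∀ i → f i ≤ g i) → sumFin n f ≤ sumFin n g
sumFin-mono-≤ zero    le = z≤n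
sumFin-mono-≤ (suc n) le = +-mono-≤ (le zero) (sumFin-mono-≤ n (λ i → le (suc i)))

sumFin-const-1 : (n : ℕ) → sumFin n (λ _ → 1) ≡ n
sumFin-const-1 zero    = refl
sumFin-const-1 (suc n) = cong suc (sumFin-const-1 n)

sumFin-δ : (n : ℕ) (i : Fin n) (f : Fin n → ℕ) → sumFin n (λ j → b2n (j == i) * f j) ≡ f i
sumFin-δ (suc n) zero f = begin
  f zero + 0 + rest ≡⟨ cong₂ _+_ (+-identityʳ (f zero)) rest≡0 ⟩
  f zero + 0        ≡⟨ +-identityʳ (f zero) ⟩
  f zero ∎
  where
  open ≡-Reasoning
  rest : ℕ
  rest = sumFin n (λ j → b2n (suc j == zero) * f (suc j))
  rest≡0 : rest ≡ 0
  rest≡0 = sumFin-zero n _ (λ j → cong (λ b → b2n b * f (suc j)) (≢⇒==false {a = suc j} {b = zero} λ ()))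
sumFin-δ (suc n) (suc i) f =
  cong₂ _+_ (cong (λ b → b2n b * f zero) (≢⇒==false {a = zero} {b = suc i} λ ()))
            (trans (sumFin-cong n (λ j → cong (λ b → b2n b * f (suc j)) (==-injective suc Fin.suc-injective j i)))
                   (sumFin-δ n i (λ j → f (suc j))))

sumFin-δ′ : (n : ℕ) (i : Fin n) (f : Fin n → ℕ) → sumFin n (λ j → b2n (i == j) * f j) ≡ f i
sumFin-δ′ n i f = trans (sumFin-cong n (λ j → cong (λ b → b2n b * f j) (==-sym i j))) (sumFin-δ n i f)

sumFin∖ : (n : ℕ) (i : Fin n) → (Fin n → ℕ) → ℕ
sumFin∖ n i f = sumFin n (λ j → b2n (not (j == i)) * f j)

sumFin-split : (n : ℕ) (i : Fin n) (f : Fin n → ℕ) → sumFin n f ≡ f i + sumFin∖ n i f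
sumFin-split n i f = begin
  sumFin n f                                                     ≡⟨ sumFin-cong n (λ j → split (j == i) (f j)) ⟩
  sumFin n (λ j → b2n (j == i) * f j + b2n (not (j == i)) * f j) ≡⟨ sumFin-+ n _ _ ⟩
  sumFin n (λ j → b2n (j == i) * f j) + sumFin∖ n i f            ≡⟨ cong (_+ sumFin∖ n i f) (sumFin-δ n i f) ⟩
  f i + sumFin∖ n i f ∎
  where
  open ≡-Reasoning
  split : (b : Bool) (x : ℕ) → x ≡ b2n b * x + b2n (not b) * x
  split true  x = trans (sym (+-identityʳ x)) (cong (_+ 0) (sym (+-identityʳ x)))
  split false x = sym (+-identityʳ x)

sumFin∖-≡ : (n : ℕ) {i j : Fin n} (f : Fin n → ℕ) → i ≢ j → b2n (not (j == i)) * f j ≡ f j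
sumFin∖-≡ n f i≢j rewrite ≢⇒==false (λ j≡i → i≢j (sym j≡i)) = +-identityʳ _

term≤sumFin : (n : ℕ) (i : Fin n) (f : Fin n → ℕ) → f i ≤ sumFin n f
term≤sumFin n i f = subst (f i ≤_) (sym (sumFin-split n i f)) (m≤m+n (f i) _)

two-terms≤sumFin : (n : ℕ) (f : Fin n → ℕ) {i j : Fin n} → i ≢ j → f i + f j ≤ sumFin n f
two-terms≤sumFin n f {i} {j} i≢j = subst (f i + f j ≤_) (sym (sumFin-split n i f))
  (+-monoʳ-≤ (f i) (subst (_≤ sumFin∖ n i f) (sumFin∖-≡ n f i≢j) (term≤sumFin n j _)))

three-terms≤sumFin : (n : ℕ) (f : Fin n → ℕ) {i j k : Fin n} → i ≢ j → i ≢ k → j ≢ k →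
                     f i + (f j + f k) ≤ sumFin n f
three-terms≤sumFin n f {i} {j} {k} i≢j i≢k j≢k = subst (f i + (f j + f k) ≤_) (sym (sumFin-split n i f))
  (+-monoʳ-≤ (f i) (subst (_≤ sumFin∖ n i f) (cong₂ _+_ (sumFin∖-≡ n f i≢j) (sumFin∖-≡ n f i≢k))
                          (two-terms≤sumFin n _ j≢k)))

sumFin-positive : (n : ℕ) (f : Fin n → ℕ) → 0 < sumFin n f → ∃ λ i → 0 < f i
sumFin-positive (suc n) f lt with f zero in eq
... | suc _ = zero , subst (0 <_) (sym eq) (s≤s z≤n)
... | zero with sumFin-positive n (λ i → f (suc i)) lt
...   | i , pos = suc i , pos

sumFin-++ : (n m : ℕ) (f : Fin (n + m) → ℕ) →
            sumFin (n + m) f ≡ sumFin n (λ i → f (i ↑ˡ m)) + sumFin m (λ j → f (n ↑ʳ j))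
sumFin-++ zero    m f = refl
sumFin-++ (suc n) m f = trans (cong (f zero +_) (sumFin-++ n m (λ i → f (suc i)))) (sym (+-assoc (f zero) _ _))

sumFin≤1 : (m : ℕ) (g : Fin m → ℕ) → (∀ i → g i ≤ 1) → (∀ i j → g i ≡ 1 → g j ≡ 1 → i ≡ j) →
           sumFin m g ≤ 1
sumFin≤1 zero g le uniq = z≤n
sumFin≤1 (suc m) g le uniq with g zero in g0 | le zero
... | zero  | _ = sumFin≤1 m (λ i → g (suc i)) (λ i → le (suc i))
                    (λ i j p q → Fin.suc-injective (uniq (suc i) (suc j) p q))
... | suc zero | _ = ≤-reflexive (cong suc (sumFin-zero m _ others-0))
  where
  others-0 : ∀ i → g (suc i) ≡ 0
  others-0 i with g (suc i) in gi | le (suc i)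
  ... | zero     | _ = refl
  ... | suc zero | _ with uniq zero (suc i) g0 gi
  ...   | ()
  others-0 i | suc (suc _) | s≤s ()
sumFin≤1 (suc m) g le uniq | suc (suc _) | s≤s ()

sumFin≡n⇒all-1 : (n : ℕ) (c : Fin n → ℕ) → (∀ i → c i ≤ 1) → sumFin n c ≡ n → ∀ i → c i ≡ 1
sumFin≡n⇒all-1 (suc n) c le eq i with c zero in c0 | le zero
... | suc zero | _ = go i
  where
  go : ∀ i → c i ≡ 1
  go zero     = c0
  go (suc i′) = sumFin≡n⇒all-1 n (λ j → c (suc j)) (λ j → le (suc j)) (suc-injective eq) i′
... | zero | _ = ⊥-elim (<-irrefl refl (≤-trans (≤-reflexive (sym eq)) rest≤n))
  where
  rest≤n : sumFin n (λ j → c (suc j)) ≤ n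
  rest≤n = ≤-trans (sumFin-mono-≤ n (λ j → le (suc j))) (≤-reflexive (sumFin-const-1 n))
sumFin≡n⇒all-1 (suc n) c le eq i | suc (suc _) | s≤s ()

-- An injective endomap of a finite set is onto, so each point is hit exactly once.
sumFin-reindex : (m : ℕ) (p : Fin m → Fin m) → (∀ x y → p x ≡ p y → x ≡ y) →
                 (F : Fin m → ℕ) → sumFin m (λ o → F (p o)) ≡ sumFin m F
sumFin-reindex m p p-inj F = begin
  sumFin m (λ o → F (p o))                                  ≡⟨ sumFin-cong m (λ o → sym (sumFin-δ m (p o) F)) ⟩
  sumFin m (λ o → sumFin m (λ o′ → b2n (o′ == p o) * F o′)) ≡⟨ sumFin-swap m m _ ⟩
  sumFin m (λ o′ → sumFin m (λ o → b2n (o′ == p o) * F o′)) ≡⟨ sumFin-cong m pull-out ⟩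
  sumFin m (λ o′ → F o′ * hits o′)                          ≡⟨ sumFin-cong m (λ o′ → cong (F o′ *_) (hits≡1 o′)) ⟩
  sumFin m (λ o′ → F o′ * 1)                                ≡⟨ sumFin-cong m (λ o′ → *-identityʳ (F o′)) ⟩
  sumFin m F ∎
  where
  open ≡-Reasoning
  hits : Fin m → ℕ
  hits o′ = sumFin m (λ o → b2n (o′ == p o))
  pull-out : ∀ o′ → sumFin m (λ o → b2n (o′ == p o) * F o′) ≡ F o′ * hits o′
  pull-out o′ = trans (sumFin-cong m (λ o → *-comm (b2n (o′ == p o)) (F o′))) (sumFin-*ˡ m (F o′) _)
  b2n≡1 : (b : Bool) → b2n b ≡ 1 → b ≡ true
  b2n≡1 true _ = refl
  hits≤1 : ∀ o′ → hits o′ ≤ 1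
  hits≤1 o′ = sumFin≤1 m _ (λ o → b2n≤1 _)
    (λ i j hi hj → p-inj i j (trans (sym (==⇒≡ (b2n≡1 _ hi))) (==⇒≡ (b2n≡1 _ hj))))
  total-hits : sumFin m hits ≡ m
  total-hits = trans (sumFin-swap m m _)
    (trans (sumFin-cong m (λ o → trans (sumFin-cong m (λ o′ → sym (*-identityʳ (b2n (o′ == p o)))))
                                        (sumFin-δ m (p o) (λ _ → 1))))
           (sumFin-const-1 m))
  hits≡1 : ∀ o′ → hits o′ ≡ 1
  hits≡1 = sumFin≡n⇒all-1 m hits hits≤1 total-hits

rank : (m : ℕ) (P : Fin m → Bool) → Fin m → ℕ
rank (suc m) P zero    = 0
rank (suc m) P (suc x) = b2n (P zero) + rank m (λ i → P (suc i)) x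

count : (m : ℕ) → (Fin m → Bool) → ℕ
count m P = sumFin m (λ i → b2n (P i))

rank<count : (m : ℕ) (P : Fin m → Bool) (x : Fin m) → P x ≡ true → rank m P x < count m P
rank<count (suc m) P zero    Px rewrite Px = s≤s z≤n
rank<count (suc m) P (suc x) Px = +-monoʳ-< (b2n (P zero)) (rank<count m (λ i → P (suc i)) x Px)

atRank : (m : ℕ) (P : Fin m → Bool) (r : ℕ) → r < count m P →
         Σ (Fin m) λ x → P x ≡ true × rank m P x ≡ r
atRank (suc m) P r lt with P zero in P0
atRank (suc m) P zero    lt       | true = zero , P0 , refl
atRank (suc m) P (suc r) (s≤s lt) | true with atRank m (λ i → P (suc i)) r lt
... | x , Px , rx = suc x , Px , cong₂ _+_ (cong b2n P0) rx
atRank (suc m) P r       lt       | false with atRank m (λ i → P (suc i)) r lt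
... | x , Px , rx = suc x , Px , cong₂ _+_ (cong b2n P0) rx

rank-injective : (m : ℕ) (P : Fin m → Bool) (x y : Fin m) → P x ≡ true → P y ≡ true →
                 rank m P x ≡ rank m P y → x ≡ y
rank-injective (suc m) P zero    zero    Px Py eq = refl
rank-injective (suc m) P zero    (suc y) Px Py eq rewrite Px = ⊥-elim (0≢1+n eq)
rank-injective (suc m) P (suc x) zero    Px Py eq rewrite Py = ⊥-elim (0≢1+n (sym eq))
rank-injective (suc m) P (suc x) (suc y) Px Py eq =
  cong suc (rank-injective m (λ i → P (suc i)) x y Px Py (+-cancelˡ-≡ (b2n (P zero)) _ _ eq))

rank-cong : (m : ℕ) (P Q : Fin m → Bool) → (∀ o → P o ≡ Q o) → ∀ x → rank m P x ≡ rank m Q x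
rank-cong (suc m) P Q eq zero    = refl
rank-cong (suc m) P Q eq (suc x) =
  cong₂ _+_ (cong b2n (eq zero)) (rank-cong m (λ i → P (suc i)) (λ i → Q (suc i)) (λ i → eq (suc i)) x)

-- Matching the valid points of a finite set along a key map τ: the point of rank r
-- among those with key k goes to the point of rank r among those with key τ k.
module RankMatching {m : ℕ} {K : Set} (_≈ᵇ_ : K → K → Bool)
                    (≈ᵇ-refl : ∀ k → (k ≈ᵇ k) ≡ true)
                    (≈ᵇ-sym : ∀ k l → (k ≈ᵇ l) ≡ (l ≈ᵇ k))
                    (≈ᵇ-trans : ∀ k l j → (k ≈ᵇ l) ≡ true → (l ≈ᵇ j) ≡ true → (k ≈ᵇ j) ≡ true)
                    (key : Fin m → K) (valid : Fin m → Bool) (τ : K → K)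
                    (τ-≈ᵇ : ∀ k l → (τ k ≈ᵇ τ l) ≡ (k ≈ᵇ l)) where

  HasKey : K → Fin m → Bool
  HasKey k o = valid o ∧ (key o ≈ᵇ k)

  multiplicity : K → ℕ
  multiplicity k = count m (HasKey k)

  ≈ᵇ-resp : ∀ {k l} → (k ≈ᵇ l) ≡ true → ∀ j → (j ≈ᵇ k) ≡ (j ≈ᵇ l)
  ≈ᵇ-resp {k} {l} k≈l j = true⇔true⇒≡ (λ j≈k → ≈ᵇ-trans j k l j≈k k≈l)
                                       (λ j≈l → ≈ᵇ-trans j l k j≈l (trans (≈ᵇ-sym l k) k≈l))

  HasKey-resp : ∀ {k l} → (k ≈ᵇ l) ≡ true → ∀ o → HasKey k o ≡ HasKey l o
  HasKey-resp k≈l o = cong (valid o ∧_) (≈ᵇ-resp k≈l (key o))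

  HasKey-own : (o : Fin m) → valid o ≡ true → HasKey (key o) o ≡ true
  HasKey-own o v rewrite v = ≈ᵇ-refl (key o)

  module Matched (multiplicity-τ : ∀ o → valid o ≡ true → multiplicity (key o) ≡ multiplicity (τ (key o))) where

    private
      image : (o : Fin m) → valid o ≡ true → Σ (Fin m) λ o′ →
              HasKey (τ (key o)) o′ ≡ true × rank m (HasKey (τ (key o))) o′ ≡ rank m (HasKey (key o)) o
      image o v = atRank m (HasKey (τ (key o))) (rank m (HasKey (key o)) o)
                    (subst (rank m (HasKey (key o)) o <_) (multiplicity-τ o v)
                           (rank<count m (HasKey (key o)) o (HasKey-own o v)))

      match : (o : Fin m) (b : Bool) → valid o ≡ b → Fin m
      match o false _ = o
      match o true  v = proj₁ (image o v)

      match-valid : (o : Fin m) (b : Bool) (v : valid o ≡ b) → valid (match o b v) ≡ b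
      match-valid o false v = v
      match-valid o true  v = ∧-conicalˡ _ _ (proj₁ (proj₂ (image o v)))

      match-injective : (x y : Fin m) (b c : Bool) (v : valid x ≡ b) (w : valid y ≡ c) →
                        match x b v ≡ match y c w → x ≡ y
      match-injective x y false false v w eq = eq
      match-injective x y true false v w eq with trans (sym (match-valid x true v)) (trans (cong valid eq) w)
      ... | ()
      match-injective x y false true v w eq with trans (sym (match-valid y true w)) (trans (cong valid (sym eq)) v)
      ... | ()
      match-injective x y true true v w eq =
        rank-injective m (HasKey (key x)) x y (HasKey-own x v) y-has-key same-rank
        where
        x′ : HasKey (τ (key x)) (match x true v) ≡ true × rank m (HasKey (τ (key x))) (match x true v) ≡ rank m (HasKey (key x)) x
        x′ = proj₂ (image x v)
        y′ : HasKey (τ (key y)) (match y true w) ≡ true × rank m (HasKey (τ (key y))) (match y true w) ≡ rank m (HasKey (key y)) y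
        y′ = proj₂ (image y w)
        τx≈τy : (τ (key x) ≈ᵇ τ (key y)) ≡ true
        τx≈τy = ≈ᵇ-trans (τ (key x)) (key (match x true v)) (τ (key y))
                  (trans (≈ᵇ-sym _ _) (∧-conicalʳ _ _ (proj₁ x′)))
                  (subst (λ z → (key z ≈ᵇ τ (key y)) ≡ true) (sym eq) (∧-conicalʳ _ _ (proj₁ y′)))
        x≈y : (key x ≈ᵇ key y) ≡ true
        x≈y = trans (sym (τ-≈ᵇ (key x) (key y))) τx≈τy
        y-has-key : HasKey (key x) y ≡ true
        y-has-key = trans (HasKey-resp x≈y y) (HasKey-own y w)
        same-rank : rank m (HasKey (key x)) x ≡ rank m (HasKey (key x)) y
        same-rank = begin
          rank m (HasKey (key x)) x                        ≡⟨ sym (proj₂ x′) ⟩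
          rank m (HasKey (τ (key x))) (match x true v)     ≡⟨ cong (rank m (HasKey (τ (key x)))) eq ⟩
          rank m (HasKey (τ (key x))) (match y true w)     ≡⟨ rank-cong m _ _ (HasKey-resp τx≈τy) _ ⟩
          rank m (HasKey (τ (key y))) (match y true w)     ≡⟨ proj₂ y′ ⟩
          rank m (HasKey (key y)) y                        ≡⟨ rank-cong m _ _ (HasKey-resp (trans (≈ᵇ-sym _ _) x≈y)) y ⟩
          rank m (HasKey (key x)) y ∎
          where open ≡-Reasoning

    π : Fin m → Fin m
    π o = match o (valid o) refl

    π-valid : (o : Fin m) → valid (π o) ≡ valid o
    π-valid o = match-valid o (valid o) refl

    π-key : (o : Fin m) → valid o ≡ true → (key (π o) ≈ᵇ τ (key o)) ≡ true
    π-key o = go (valid o) refl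
      where
      go : (b : Bool) (v : valid o ≡ b) → b ≡ true → (key (match o b v) ≈ᵇ τ (key o)) ≡ true
      go true v _ = ∧-conicalʳ _ _ (proj₁ (proj₂ (image o v)))

    π-injective : ∀ x y → π x ≡ π y → x ≡ y
    π-injective x y = match-injective x y (valid x) (valid y) refl refl

module BlockSwap {n t : ℕ} (cls : Fin n → Fin t)
                 (fibres≤2 : (u v w : Fin n) → cls u ≡ cls v → cls v ≡ cls w →
                             u ≡ v ⊎ (v ≡ w ⊎ u ≡ w)) where

  Partner : Fin n → Fin n → Set
  Partner w x = x ≢ w × cls x ≡ cls w

  private
    partner? : (w : Fin n) → Dec (∃ (Partner w))
    partner? w = any? (λ x → ¬? (x ≟ w) ×-dec (cls x ≟ cls w))

    swapWith : (w : Fin n) → Dec (∃ (Partner w)) → Fin n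
    swapWith w (yes (x , _)) = x
    swapWith w (no _)        = w

  σ : Fin n → Fin n
  σ w = swapWith w (partner? w)

  partner-unique : (w x y : Fin n) → Partner w x → Partner w y → x ≡ y
  partner-unique w x y (x≢w , cx) (y≢w , cy) with fibres≤2 x w y cx (sym cy)
  ... | inj₁ x≡w        = contradiction x≡w x≢w
  ... | inj₂ (inj₁ w≡y) = contradiction (sym w≡y) y≢w
  ... | inj₂ (inj₂ x≡y) = x≡y

  data BlockView (w s : Fin n) : Set where
    singleton : s ≡ w → (∀ x → cls x ≡ cls w → x ≡ w) → BlockView w s
    doublet   : Partner w s → BlockView w s

  private
    blockView′ : (w : Fin n) (d : Dec (∃ (Partner w))) → BlockView w (swapWith w d)
    blockView′ w (yes (x , p)) = doublet p
    blockView′ w (no none)     = singleton refl only-w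
      where
      only-w : ∀ x → cls x ≡ cls w → x ≡ w
      only-w x cx with x ≟ w
      ... | yes x≡w = x≡w
      ... | no x≢w  = contradiction (x , x≢w , cx) none

  blockView : (w : Fin n) → BlockView w (σ w)
  blockView w = blockView′ w (partner? w)

  σ-partner : (w x : Fin n) → Partner w x → σ w ≡ x
  σ-partner w x p with blockView w
  ... | singleton _ only-w = contradiction (only-w x (proj₂ p)) (proj₁ p)
  ... | doublet q          = partner-unique w (σ w) x q p

  σ-cls : (w : Fin n) → cls (σ w) ≡ cls w
  σ-cls w with blockView w
  ... | singleton σw≡w _ = cong cls σw≡w
  ... | doublet (_ , c)  = c

  σ-involutive : (w : Fin n) → σ (σ w) ≡ w
  σ-involutive w with blockView w
  ... | singleton σw≡w _ = trans (cong σ σw≡w) σw≡w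
  ... | doublet (σw≢w , c) = σ-partner (σ w) w ((λ w≡σw → σw≢w (sym w≡σw)) , sym c)

  σ-injective : ∀ {x y} → σ x ≡ σ y → x ≡ y
  σ-injective {x} {y} eq = trans (sym (σ-involutive x)) (trans (cong σ eq) (σ-involutive y))

  b2n-sameBlock : (w b : Fin n) →
    b2n (cls w == cls b) ≡ b2n (w == b) + b2n (not (σ b == b) ∧ (w == σ b))
  b2n-sameBlock w b with ==-view w b
  b2n-sameBlock w b | equal refl w==w rewrite ==-refl (cls w) | w==w with ==-view (σ w) w
  ... | equal _ σw==w rewrite σw==w = refl
  ... | distinct σw≢w σw==w rewrite σw==w | ≢⇒==false {a = w} {b = σ w} (λ p → σw≢w (sym p)) = refl
  b2n-sameBlock w b | distinct w≢b w==b rewrite w==b with ==-view (cls w) (cls b)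
  ... | equal c c== rewrite c== | σ-partner b w (w≢b , c) | ≢⇒==false w≢b | ==-refl w = refl
  ... | distinct c≢ c== rewrite c== with ==-view w (σ b)
  ...   | equal w≡σb _ = contradiction (trans (cong cls w≡σb) (σ-cls b)) c≢
  ...   | distinct _ w==σb rewrite w==σb with σ b == b
  ...     | true  = refl
  ...     | false = refl

  σ-unique : ∀ w v → ((∀ x → cls x ≡ cls w → x ≡ w) → v ≡ w) →
             (∀ x → cls x ≡ cls w → x ≢ w → v ≡ x) → v ≡ σ w
  σ-unique w v if-alone if-paired with blockView w
  ... | singleton σw≡w alone = trans (if-alone alone) (sym σw≡w)
  ... | doublet (σw≢w , c)   = if-paired (σ w) c σw≢w

reverse : Kind → Kind
reverse U = U
reverse O = I
reverse I = O

reverse-involutive : ∀ k → reverse (reverse k) ≡ k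
reverse-involutive U = refl
reverse-involutive O = refl
reverse-involutive I = refl

private
  ∧-additive : (p : Bool) {c d e : Bool} → b2n c ≡ b2n d + b2n e →
               b2n (p ∧ c) ≡ b2n (p ∧ d) + b2n (p ∧ e)
  ∧-additive true  eq = eq
  ∧-additive false eq = refl

  ∧-scale : (p c q : Bool) → b2n (p ∧ (c ∧ q)) ≡ b2n c * b2n (p ∧ q)
  ∧-scale true  true  q = sym (+-identityʳ _)
  ∧-scale true  false q = refl
  ∧-scale false true  q = refl
  ∧-scale false false q = refl

into-additive : {n : ℕ} (k : Kind) (a : Fin n) (C D E : Fin n → Bool) →
  (∀ w → b2n (C w) ≡ b2n (D w) + b2n (E w)) → (s : Shape (Fin n)) →
  into k a C s ≡ into k a D s + into k a E s
into-additive U a C D E h (undir x y) =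
  trans (cong₂ _+_ (∧-additive (x == a) (h y)) (∧-additive (y == a) (h x)))
        (+-CS.interchange (b2n ((x == a) ∧ D y)) (b2n ((x == a) ∧ E y)) (b2n ((y == a) ∧ D x)) (b2n ((y == a) ∧ E x)))
into-additive U a C D E h (uloop x) =
  trans (cong (2 *_) (∧-additive (x == a) (h x))) (*-distribˡ-+ 2 (b2n ((x == a) ∧ D x)) (b2n ((x == a) ∧ E x)))
into-additive U a C D E h (semi x)    = ∧-additive (x == a) (h x)
into-additive U a C D E h (dir x y)   = refl
into-additive U a C D E h (dloop x)   = refl
into-additive O a C D E h (dir x y)   = ∧-additive (x == a) (h y)
into-additive O a C D E h (dloop x)   = ∧-additive (x == a) (h x)
into-additive O a C D E h (undir x y) = refl
into-additive O a C D E h (uloop x)   = refl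
into-additive O a C D E h (semi x)    = refl
into-additive I a C D E h (dir x y)   = ∧-additive (y == a) (h x)
into-additive I a C D E h (dloop x)   = ∧-additive (x == a) (h x)
into-additive I a C D E h (undir x y) = refl
into-additive I a C D E h (uloop x)   = refl
into-additive I a C D E h (semi x)    = refl

into-scale : {n : ℕ} (k : Kind) (a : Fin n) (c : Bool) (D : Fin n → Bool) (s : Shape (Fin n)) →
  into k a (λ w → c ∧ D w) s ≡ b2n c * into k a D s
into-scale U a c D (undir x y) =
  trans (cong₂ _+_ (∧-scale (x == a) c (D y)) (∧-scale (y == a) c (D x))) (sym (*-distribˡ-+ (b2n c) _ _))
into-scale U a c D (uloop x) =
  trans (cong (2 *_) (∧-scale (x == a) c (D x))) (*-CS.x∙yz≈y∙xz 2 (b2n c) _)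
into-scale U a c D (semi x)    = ∧-scale (x == a) c (D x)
into-scale U a c D (dir x y)   = sym (*-zeroʳ (b2n c))
into-scale U a c D (dloop x)   = sym (*-zeroʳ (b2n c))
into-scale O a c D (dir x y)   = ∧-scale (x == a) c (D y)
into-scale O a c D (dloop x)   = ∧-scale (x == a) c (D x)
into-scale O a c D (undir x y) = sym (*-zeroʳ (b2n c))
into-scale O a c D (uloop x)   = sym (*-zeroʳ (b2n c))
into-scale O a c D (semi x)    = sym (*-zeroʳ (b2n c))
into-scale I a c D (dir x y)   = ∧-scale (y == a) c (D x)
into-scale I a c D (dloop x)   = ∧-scale (x == a) c (D x)
into-scale I a c D (undir x y) = sym (*-zeroʳ (b2n c))
into-scale I a c D (uloop x)   = sym (*-zeroʳ (b2n c))
into-scale I a c D (semi x)    = sym (*-zeroʳ (b2n c))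

into-reverse : {n : ℕ} (k : Kind) (a b : Fin n) (s : Shape (Fin n)) →
  into k a (_== b) s ≡ into (reverse k) b (_== a) s
into-reverse U a b (undir x y) =
  trans (cong₂ _+_ (cong b2n (∧-comm (x == a) (y == b))) (cong b2n (∧-comm (y == a) (x == b))))
        (+-comm (b2n ((y == b) ∧ (x == a))) (b2n ((x == b) ∧ (y == a))))
into-reverse U a b (uloop x)   = cong (λ c → 2 * b2n c) (∧-comm (x == a) (x == b))
into-reverse U a b (semi x)    = cong b2n (∧-comm (x == a) (x == b))
into-reverse U a b (dir x y)   = refl
into-reverse U a b (dloop x)   = refl
into-reverse O a b (dir x y)   = cong b2n (∧-comm (x == a) (y == b))
into-reverse O a b (dloop x)   = cong b2n (∧-comm (x == a) (x == b))
into-reverse O a b (undir x y) = refl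
into-reverse O a b (uloop x)   = refl
into-reverse O a b (semi x)    = refl
into-reverse I a b (dir x y)   = cong b2n (∧-comm (y == a) (x == b))
into-reverse I a b (dloop x)   = cong b2n (∧-comm (x == a) (x == b))
into-reverse I a b (undir x y) = refl
into-reverse I a b (uloop x)   = refl
into-reverse I a b (semi x)    = refl

deg-additive : (H : Graph) (k : Kind) (a : Fin (nV H)) (C D E : Fin (nV H) → Bool) (α : ℕ) →
  (∀ w → b2n (C w) ≡ b2n (D w) + b2n (E w)) → deg H k a C α ≡ deg H k a D α + deg H k a E α
deg-additive H k a C D E α h =
  trans (sumFin-cong (nE H) (λ e → trans (if-then-0-cong (ecol H e ≡ᵇ α) (into-additive k a C D E h (shape H e)))
                                          (if-then-0-+ (ecol H e ≡ᵇ α) _ _)))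
        (sumFin-+ (nE H) _ _)

deg-scale : (H : Graph) (k : Kind) (a : Fin (nV H)) (c : Bool) (D : Fin (nV H) → Bool) (α : ℕ) →
  deg H k a (λ w → c ∧ D w) α ≡ b2n c * deg H k a D α
deg-scale H k a c D α =
  trans (sumFin-cong (nE H) (λ e → trans (if-then-0-cong (ecol H e ≡ᵇ α) (into-scale k a c D (shape H e)))
                                          (if-then-0-* (ecol H e ≡ᵇ α) (b2n c) (into k a D (shape H e)))))
        (sumFin-*ˡ (nE H) (b2n c) _)

cross-cancel : ∀ x y w z → x + y ≡ w + z → x + w ≡ y + z → x ≡ z
cross-cancel x y w z e₁ e₂ = *-cancelˡ-≡ x z 2 (+-cancelʳ-≡ (y + w) (2 * x) (2 * z) eq)
  where
  open ≡-Reasoning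
  eq : 2 * x + (y + w) ≡ 2 * z + (y + w)
  eq = begin
    2 * x + (y + w)    ≡⟨ cong (λ v → x + v + (y + w)) (+-identityʳ x) ⟩
    (x + x) + (y + w)  ≡⟨ +-CS.interchange x x y w ⟩
    (x + y) + (x + w)  ≡⟨ cong₂ _+_ e₁ e₂ ⟩
    (w + z) + (y + z)  ≡⟨ cong (_+ (y + z)) (+-comm w z) ⟩
    (z + w) + (y + z)  ≡⟨ +-CS.interchange z w y z ⟩
    (z + y) + (w + z)  ≡⟨ cong ((z + y) +_) (+-comm w z) ⟩
    (z + y) + (z + w)  ≡⟨ +-CS.interchange z y z w ⟩
    (z + z) + (y + w)  ≡⟨ cong (λ v → z + v + (y + w)) (+-identityʳ z) ⟨
    2 * z + (y + w) ∎

module MultiplicitySymmetry (H : Graph) {t : ℕ} (cls : Fin (nV H) → Fin t)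
  (fibres≤2 : (u v w : Fin (nV H)) → cls u ≡ cls v → cls v ≡ cls w → u ≡ v ⊎ (v ≡ w ⊎ u ≡ w))
  (equitable : Equitable H cls) where

  open BlockSwap cls fibres≤2 public

  mult : Kind → Fin (nV H) → Fin (nV H) → ℕ → ℕ
  mult k a b α = deg H k a (_== b) α

  mult-reverse : ∀ k a b α → mult k a b α ≡ mult (reverse k) b a α
  mult-reverse k a b α = sumFin-cong (nE H) (λ e → if-then-0-cong (ecol H e ≡ᵇ α) (into-reverse k a b (shape H e)))

  mult-reverse′ : ∀ k a b α → mult (reverse k) a b α ≡ mult k b a α
  mult-reverse′ k a b α = trans (mult-reverse (reverse k) a b α) (cong (λ k′ → mult k′ b a α) (reverse-involutive k))

  Block : Fin (nV H) → Fin (nV H) → Bool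
  Block b w = cls w == cls b

  deg-Block : ∀ k a b α → deg H k a (Block b) α ≡ mult k a b α + b2n (not (σ b == b)) * mult k a (σ b) α
  deg-Block k a b α =
    trans (deg-additive H k a (Block b) (_== b) (λ w → not (σ b == b) ∧ (w == σ b)) α (λ w → b2n-sameBlock w b))
          (cong (mult k a b α +_) (deg-scale H k a (not (σ b == b)) (_== σ b) α))

  deg-Block-singleton : ∀ k a b α → σ b ≡ b → deg H k a (Block b) α ≡ mult k a b α
  deg-Block-singleton k a b α σb≡b = begin
    deg H k a (Block b) α                                   ≡⟨ deg-Block k a b α ⟩
    mult k a b α + b2n (not (σ b == b)) * mult k a (σ b) α ≡⟨ cong (λ c → mult k a b α + b2n (not c) * mult k a (σ b) α)
                                                                 (trans (cong (_== b) σb≡b) (==-refl b)) ⟩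
    mult k a b α + 0                                        ≡⟨ +-identityʳ _ ⟩
    mult k a b α ∎
    where open ≡-Reasoning

  deg-Block-doublet : ∀ k a b α → σ b ≢ b → deg H k a (Block b) α ≡ mult k a b α + mult k a (σ b) α
  deg-Block-doublet k a b α σb≢b = begin
    deg H k a (Block b) α                                   ≡⟨ deg-Block k a b α ⟩
    mult k a b α + b2n (not (σ b == b)) * mult k a (σ b) α ≡⟨ cong (λ c → mult k a b α + b2n (not c) * mult k a (σ b) α)
                                                                 (≢⇒==false σb≢b) ⟩
    mult k a b α + 1 * mult k a (σ b) α                     ≡⟨ cong (mult k a b α +_) (*-identityˡ _) ⟩
    mult k a b α + mult k a (σ b) α ∎
    where open ≡-Reasoning

  deg-Block-σ : ∀ k a b α → deg H k a (Block b) α ≡ deg H k (σ a) (Block b) α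
  deg-Block-σ k a b α = proj₂ (equitable a (σ a) (sym (σ-cls a))) (cls b) α k

  -- Between doublets, equitability at a and, reversed, at b gives two linear equations
  -- in the four multiplicities between the blocks, which force the claim.
  mult-σ : ∀ k a b α → mult k a b α ≡ mult k (σ a) (σ b) α
  mult-σ k a b α with blockView a | blockView b
  ... | singleton σa≡a _ | singleton σb≡b _ rewrite σa≡a | σb≡b = refl
  ... | singleton σa≡a _ | doublet (σb≢b , _) rewrite σa≡a = begin
    mult k a b α                        ≡⟨ mult-reverse k a b α ⟩
    mult (reverse k) b a α              ≡⟨ deg-Block-singleton (reverse k) b a α σa≡a ⟨
    deg H (reverse k) b (Block a) α     ≡⟨ deg-Block-σ (reverse k) b a α ⟩
    deg H (reverse k) (σ b) (Block a) α ≡⟨ deg-Block-singleton (reverse k) (σ b) a α σa≡a ⟩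
    mult (reverse k) (σ b) a α          ≡⟨ mult-reverse′ k (σ b) a α ⟩
    mult k a (σ b) α ∎
    where open ≡-Reasoning
  ... | doublet (σa≢a , _) | singleton σb≡b _ rewrite σb≡b = begin
    mult k a b α                    ≡⟨ deg-Block-singleton k a b α σb≡b ⟨
    deg H k a (Block b) α           ≡⟨ deg-Block-σ k a b α ⟩
    deg H k (σ a) (Block b) α       ≡⟨ deg-Block-singleton k (σ a) b α σb≡b ⟩
    mult k (σ a) b α ∎
    where open ≡-Reasoning
  ... | doublet (σa≢a , _) | doublet (σb≢b , _) = cross-cancel _ _ _ _ out-of-a into-a
    where
    open ≡-Reasoning
    out-of-a : mult k a b α + mult k a (σ b) α ≡ mult k (σ a) b α + mult k (σ a) (σ b) α
    out-of-a = begin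
      mult k a b α + mult k a (σ b) α           ≡⟨ deg-Block-doublet k a b α σb≢b ⟨
      deg H k a (Block b) α                     ≡⟨ deg-Block-σ k a b α ⟩
      deg H k (σ a) (Block b) α                 ≡⟨ deg-Block-doublet k (σ a) b α σb≢b ⟩
      mult k (σ a) b α + mult k (σ a) (σ b) α ∎
    into-a : mult k a b α + mult k (σ a) b α ≡ mult k a (σ b) α + mult k (σ a) (σ b) α
    into-a = begin
      mult k a b α + mult k (σ a) b α                       ≡⟨ cong₂ _+_ (mult-reverse k a b α) (mult-reverse k (σ a) b α) ⟩
      mult (reverse k) b a α + mult (reverse k) b (σ a) α   ≡⟨ deg-Block-doublet (reverse k) b a α σa≢a ⟨
      deg H (reverse k) b (Block a) α                       ≡⟨ deg-Block-σ (reverse k) b a α ⟩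
      deg H (reverse k) (σ b) (Block a) α                   ≡⟨ deg-Block-doublet (reverse k) (σ b) a α σa≢a ⟩
      mult (reverse k) (σ b) a α + mult (reverse k) (σ b) (σ a) α
                                                            ≡⟨ cong₂ _+_ (mult-reverse′ k (σ b) a α) (mult-reverse′ k (σ b) (σ a) α) ⟩
      mult k a (σ b) α + mult k (σ a) (σ b) α ∎

even-or-odd : ∀ k → ∃ λ q → k ≡ q + q ⊎ k ≡ suc (q + q)
even-or-odd zero = 0 , inj₁ refl
even-or-odd (suc k) with even-or-odd k
... | q , inj₁ k≡2q   = q , inj₂ (cong suc k≡2q)
... | q , inj₂ k≡2q+1 = suc q , inj₁ (trans (cong suc k≡2q+1) (cong suc (sym (+-suc q q))))

<ᵇ-false : ∀ {x y} → ¬ x < y → (x <ᵇ y) ≡ false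
<ᵇ-false {x} {y} x≮y with x <ᵇ y in eq
... | false = refl
... | true  = contradiction (<ᵇ⇒< x y (subst T (sym eq) _)) x≮y

<ᵇ-true : ∀ {x y} → x < y → (x <ᵇ y) ≡ true
<ᵇ-true {x} {y} x<y with x <ᵇ y in eq
... | true  = refl
... | false = ⊥-elim (subst T eq (<⇒<ᵇ x<y))

<ᵇ-flip : ∀ x y → x ≢ y → (y <ᵇ x) ≡ not (x <ᵇ y)
<ᵇ-flip x y x≢y with <-cmp x y
... | tri< x<y _ y≮x = trans (<ᵇ-false y≮x) (cong not (sym (<ᵇ-true x<y)))
... | tri≈ _ x≡y _   = contradiction x≡y x≢y
... | tri> x≮y _ y<x = trans (<ᵇ-true y<x) (cong not (sym (<ᵇ-false x≮y)))

-- Two involutions a, b of a finite set, without fixed points on an (a,b)-closed part D,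
-- generate there a union of even alternating cycles, so D can be 2-coloured with a and b
-- both flipping the colour.  The colour of e compares the least point of the b∘a-orbit
-- of e with that of a e: these orbits are disjoint, b∘a preserves both, and a, b swap them.
module AlternatingColouring (N : ℕ) (a b : Fin N → Fin N)
  (a-involutive : ∀ e → a (a e) ≡ e) (b-involutive : ∀ e → b (b e) ≡ e)
  (D : Fin N → Set) (D-a : ∀ {e} → D e → D (a e)) (D-b : ∀ {e} → D e → D (b e))
  (a-no-fixpoint : ∀ {e} → D e → a e ≢ e) (b-no-fixpoint : ∀ {e} → D e → b e ≢ e) where

  ρ : Fin N → Fin N
  ρ e = b (a e)

  ρ^ : ℕ → Fin N → Fin N
  ρ^ zero    e = e
  ρ^ (suc k) e = ρ^ k (ρ e)

  ρ^-comm : ∀ k e → ρ^ k (ρ e) ≡ ρ (ρ^ k e)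
  ρ^-comm zero    e = refl
  ρ^-comm (suc k) e = ρ^-comm k (ρ e)

  ρ^-+ : ∀ i j e → ρ^ (i + j) e ≡ ρ^ i (ρ^ j e)
  ρ^-+ zero    j e = refl
  ρ^-+ (suc i) j e = trans (ρ^-+ i j (ρ e)) (cong (ρ^ i) (ρ^-comm j e))

  ρ^-* : ∀ {z p} → ρ^ p z ≡ z → ∀ q → ρ^ (q * p) z ≡ z
  ρ^-* ρ^pz≡z zero = refl
  ρ^-* {z} {p} ρ^pz≡z (suc q) = trans (ρ^-+ p (q * p) z) (trans (cong (ρ^ p) (ρ^-* ρ^pz≡z q)) ρ^pz≡z)

  ρ-injective : ∀ {x y} → ρ x ≡ ρ y → x ≡ y
  ρ-injective {x} {y} eq = trans (sym (a-involutive x))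
    (trans (cong a (trans (sym (b-involutive (a x))) (trans (cong b eq) (b-involutive (a y))))) (a-involutive y))

  ρ^-injective : ∀ k {x y} → ρ^ k x ≡ ρ^ k y → x ≡ y
  ρ^-injective zero    eq = eq
  ρ^-injective (suc k) eq = ρ-injective (ρ^-injective k eq)

  -- conjugating ρ^ n by a inverts it
  ρ^-a-ρ^ : ∀ n z → ρ^ n (a (ρ^ n z)) ≡ a z
  ρ^-a-ρ^ zero    z = refl
  ρ^-a-ρ^ (suc n) z = trans (cong (λ w → ρ^ n (ρ (a w))) (ρ^-comm n z))
                            (trans (cong (ρ^ n) ρ-a-ρ) (ρ^-a-ρ^ n z))
    where
    ρ-a-ρ : ρ (a (ρ (ρ^ n z))) ≡ a (ρ^ n z)
    ρ-a-ρ = trans (cong b (a-involutive (b (a (ρ^ n z))))) (b-involutive (a (ρ^ n z)))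

  D-ρ^ : ∀ {e} → D e → ∀ k → D (ρ^ k e)
  D-ρ^ d zero    = d
  D-ρ^ d (suc k) = D-ρ^ (D-b (D-a d)) k

  period : ∀ e → ∃ λ p → 0 < p × p ≤ N × ρ^ p e ≡ e
  period e with pigeonhole (n<1+n N) (λ (i : Fin (suc N)) → ρ^ (toℕ i) e)
  ... | i , j , i<j , eq = toℕ j ∸ toℕ i , m<n⇒0<n∸m i<j , p≤N , ρ^-injective (toℕ i) shifted
    where
    p≤N : toℕ j ∸ toℕ i ≤ N
    p≤N = ≤-trans (m∸n≤m (toℕ j) (toℕ i)) (s≤s⁻¹ (toℕ<n j))
    shifted : ρ^ (toℕ i) (ρ^ (toℕ j ∸ toℕ i) e) ≡ ρ^ (toℕ i) e
    shifted = trans (sym (ρ^-+ (toℕ i) _ e))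
                    (trans (cong (λ z → ρ^ z e) (trans (+-comm (toℕ i) _) (m∸n+n≡m (<⇒≤ i<j)))) (sym eq))

  least : ℕ → Fin N → ℕ
  least zero    e = toℕ e
  least (suc K) e = toℕ e ⊓ least K (ρ e)

  least-≤ : ∀ K k e → k ≤ K → least K e ≤ toℕ (ρ^ k e)
  least-≤ zero    zero    e _ = ≤-refl
  least-≤ (suc K) zero    e _ = m⊓n≤m (toℕ e) _
  least-≤ (suc K) (suc k) e (s≤s k≤K) = ≤-trans (m⊓n≤n (toℕ e) _) (least-≤ K k (ρ e) k≤K)

  least-attained : ∀ K e → ∃ λ k → k ≤ K × least K e ≡ toℕ (ρ^ k e)
  least-attained zero    e = 0 , z≤n , refl
  least-attained (suc K) e with ⊓-sel (toℕ e) (least K (ρ e))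
  ... | inj₁ eq = 0 , z≤n , eq
  ... | inj₂ eq with least-attained K (ρ e)
  ...   | k , k≤K , eq′ = suc k , s≤s k≤K , trans eq eq′

  orbitMin : Fin N → ℕ
  orbitMin e = least N e

  orbitMin-ρ : ∀ e → orbitMin (ρ e) ≡ orbitMin e
  orbitMin-ρ e = ≤-antisym ≤-min ≥-min
    where
    ≤-min : orbitMin (ρ e) ≤ orbitMin e
    ≤-min with least-attained N e
    ... | suc k , k<N , eq = subst (orbitMin (ρ e) ≤_) (sym eq) (least-≤ N k (ρ e) (≤-trans (n≤1+n k) k<N))
    ... | zero  , _   , eq with period e
    ...   | suc p , _ , p<N , ρ^pe≡e =
      subst (orbitMin (ρ e) ≤_) (sym eq)
            (subst (λ z → orbitMin (ρ e) ≤ toℕ z) ρ^pe≡e (least-≤ N p (ρ e) (≤-trans (n≤1+n p) p<N)))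
    ≥-min : orbitMin e ≤ orbitMin (ρ e)
    ≥-min with least-attained N (ρ e)
    ... | k , k≤N , eq with suc k ≤? N
    ...   | yes k<N = subst (orbitMin e ≤_) (sym eq) (least-≤ N (suc k) e k<N)
    ...   | no  k≮N with period e
    ...     | p , p>0 , p≤N , ρ^pe≡e =
      subst (orbitMin e ≤_) (sym eq) (subst (λ z → orbitMin e ≤ toℕ z) wrap (least-≤ N (suc N ∸ p) e (∸-monoʳ-≤ (suc N) p>0)))
      where
      k≡N : k ≡ N
      k≡N = ≤-antisym k≤N (≮⇒≥ k≮N)
      wrap : ρ^ (suc N ∸ p) e ≡ ρ^ k (ρ e)
      wrap = trans (cong (ρ^ (suc N ∸ p)) (sym ρ^pe≡e))
                   (trans (sym (ρ^-+ (suc N ∸ p) p e))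
                          (cong (λ z → ρ^ z e) (trans (m∸n+n≡m (≤-trans p≤N (n≤1+n N))) (cong suc (sym k≡N)))))

  -- an even or odd number of steps from e to a e would give a fixed point of a or of b
  a-off-orbit : ∀ {e} → D e → ∀ k → a e ≢ ρ^ k e
  a-off-orbit {e} d k ae≡ρ^ke with even-or-odd k
  ... | q , inj₁ k≡2q = a-no-fixpoint (D-ρ^ d q)
        (ρ^-injective q (trans (ρ^-a-ρ^ q e) (trans ae≡ρ^ke (trans (cong (λ z → ρ^ z e) k≡2q) (ρ^-+ q q e)))))
  ... | q , inj₂ k≡2q+1 = b-no-fixpoint (D-ρ^ d (suc q))
        (trans (sym (cong b (a-involutive (ρ^ (suc q) e))))
               (ρ^-injective q (trans (ρ^-a-ρ^ (suc q) e)
                 (trans ae≡ρ^ke (trans (cong (λ z → ρ^ z e) (trans k≡2q+1 (sym (+-suc q q)))) (ρ^-+ q (suc q) e))))))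

  orbitMin-a : ∀ {e} → D e → orbitMin e ≢ orbitMin (a e)
  orbitMin-a {e} d eq with least-attained N e | least-attained N (a e) | period e
  ... | i , _ , ei | j , _ , ej | suc p , _ , _ , ρ^pe≡e = a-off-orbit d (j * p + i) ae-on-orbit
    where
    ρ^ie≡ρ^jae : ρ^ i e ≡ ρ^ j (a e)
    ρ^ie≡ρ^jae = toℕ-injective (trans (sym ei) (trans eq ej))
    ρ^pae≡ae : ρ^ (suc p) (a e) ≡ a e
    ρ^pae≡ae = trans (cong (λ w → ρ^ (suc p) (a w)) (sym ρ^pe≡e)) (ρ^-a-ρ^ (suc p) e)
    ae-on-orbit : a e ≡ ρ^ (j * p + i) e
    ae-on-orbit = begin
      a e                          ≡⟨ ρ^-* ρ^pae≡ae j ⟨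
      ρ^ (j * suc p) (a e)         ≡⟨ cong (λ z → ρ^ z (a e)) (trans (*-suc j p) (+-comm j (j * p))) ⟩
      ρ^ (j * p + j) (a e)         ≡⟨ ρ^-+ (j * p) j (a e) ⟩
      ρ^ (j * p) (ρ^ j (a e))      ≡⟨ cong (ρ^ (j * p)) ρ^ie≡ρ^jae ⟨
      ρ^ (j * p) (ρ^ i e)          ≡⟨ ρ^-+ (j * p) i e ⟨
      ρ^ (j * p + i) e ∎
      where open ≡-Reasoning

  colour : Fin N → Bool
  colour e = orbitMin e <ᵇ orbitMin (a e)

  colour-a : ∀ {e} → D e → colour (a e) ≡ not (colour e)
  colour-a {e} d = trans (cong (λ z → orbitMin (a e) <ᵇ orbitMin z) (a-involutive e))
                         (<ᵇ-flip (orbitMin e) (orbitMin (a e)) (orbitMin-a d))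

  colour-b : ∀ {e} → D e → colour (b e) ≡ not (colour e)
  colour-b {e} d = trans (cong₂ _<ᵇ_ min-be min-abe) (<ᵇ-flip (orbitMin e) (orbitMin (a e)) (orbitMin-a d))
    where
    min-be : orbitMin (b e) ≡ orbitMin (a e)
    min-be = trans (cong orbitMin (sym (cong b (a-involutive e)))) (orbitMin-ρ (a e))
    min-abe : orbitMin (a (b e)) ≡ orbitMin e
    min-abe = trans (sym (orbitMin-ρ (a (b e)))) (cong orbitMin (trans (cong b (a-involutive (b e))) (b-involutive e)))

_==ᴮ_ : Bool → Bool → Bool
true  ==ᴮ b = b
false ==ᴮ b = not b

==ᴮ-refl : ∀ b → (b ==ᴮ b) ≡ true
==ᴮ-refl true  = refl
==ᴮ-refl false = refl

==ᴮ⇒≡ : ∀ {b c} → (b ==ᴮ c) ≡ true → b ≡ c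
==ᴮ⇒≡ {true}  {true}  _ = refl
==ᴮ⇒≡ {false} {false} _ = refl

isULoop : {n : ℕ} → Shape (Fin n) → Bool
isULoop (uloop _) = true
isULoop _         = false

-- Over an undirected loop of H, G has a bipartite 2-regular graph; flip s e is the other
-- edge over the same loop at the end of e on side s.
module LoopColouring (G H : Graph) (fV : Fin (nV G) → Fin (nV H)) (fE : Fin (nE G) → Fin (nE H))
  (over : ∀ e → ShapeOver fV (shape G e) (shape H (fE e)))
  (local : ∀ x h → sumFin (nE G) (λ e′ → if fE e′ == h then into U x allV (shape G e′) else 0)
                     ≡ into U (fV x) allV (shape H h))
  (side : Fin (nV G) → Bool) (cross : ∀ e → Crosses side (shape G e)) where

  private
    EG VG : Set
    EG = Fin (nE G)
    VG = Fin (nV G)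

  OverLoop : EG → Set
  OverLoop e = isULoop (shape H (fE e)) ≡ true

  inc : VG → EG → ℕ
  inc v e = into U v allV (shape G e)

  record LoopLift (e : EG) : Set where
    field
      x y    : VG
      a₀     : Fin (nV H)
      shapeG : shape G e ≡ undir x y
      shapeH : shape H (fE e) ≡ uloop a₀
      fx     : fV x ≡ a₀
      fy     : fV y ≡ a₀
      sides  : side x ≢ side y

  loopLift : (e : EG) → OverLoop e → LoopLift e
  loopLift e = lift (shape G e) (shape H (fE e)) refl refl (over e) (cross e)
    where
    lift : (sg : Shape VG) (sh : Shape (Fin (nV H))) → shape G e ≡ sg → shape H (fE e) ≡ sh →
           ShapeOver fV sg sh → Crosses side sg → isULoop sh ≡ true → LoopLift e
    lift (undir x y) (uloop a₀) eg eh (fx , fy) c _ = record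
      { x = x ; y = y ; a₀ = a₀ ; shapeG = eg ; shapeH = eh ; fx = fx ; fy = fy ; sides = c }

  endOnSide : Bool → Shape VG → VG
  endOnSide s (undir x y) = if side x ==ᴮ s then x else y
  endOnSide s (dir x y)   = x
  endOnSide s (uloop x)   = x
  endOnSide s (dloop x)   = x
  endOnSide s (semi x)    = x

  module Ends {e : EG} (d : OverLoop e) where
    open LoopLift (loopLift e d)

    x≢y : x ≢ y
    x≢y x≡y = sides (cong side x≡y)

    inc-xy : ∀ v → inc v e ≡ b2n (x == v) + b2n (y == v)
    inc-xy v = trans (cong (into U v allV) shapeG)
                     (cong₂ _+_ (cong b2n (∧-identityʳ (x == v))) (cong b2n (∧-identityʳ (y == v))))

    end : Bool → VG
    end s = endOnSide s (shape G e)

    end-xy : ∀ s → end s ≡ (if side x ==ᴮ s then x else y)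
    end-xy s = cong (endOnSide s) shapeG

    side-y : side y ≡ not (side x)
    side-y with side x | side y | sides
    ... | true  | true  | ne = contradiction refl ne
    ... | true  | false | _  = refl
    ... | false | true  | _  = refl
    ... | false | false | ne = contradiction refl ne

    end-side : ∀ s → side (end s) ≡ s
    end-side s rewrite end-xy s with side x in sx
    end-side true  | true  = sx
    end-side false | true  = trans side-y (cong not sx)
    end-side true  | false = trans side-y (cong not sx)
    end-side false | false = sx

    end-is-x-or-y : ∀ s → end s ≡ x ⊎ end s ≡ y
    end-is-x-or-y s rewrite end-xy s with side x ==ᴮ s
    ... | true  = inj₁ refl
    ... | false = inj₂ refl

    incident⇒x-or-y : ∀ v → 0 < inc v e → v ≡ x ⊎ v ≡ y
    incident⇒x-or-y v pos rewrite inc-xy v with ==-view x v | ==-view y v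
    ... | equal x≡v _    | _              = inj₁ (sym x≡v)
    ... | distinct _ _   | equal y≡v _    = inj₂ (sym y≡v)
    ... | distinct _ x=v | distinct _ y=v rewrite x=v | y=v = contradiction pos λ ()

    inc-x-or-y : ∀ v → v ≡ x ⊎ v ≡ y → inc v e ≡ 1
    inc-x-or-y v (inj₁ refl) rewrite inc-xy v | ==-refl v | ≢⇒==false {a = y} {b = v} (λ y≡x → x≢y (sym y≡x)) = refl
    inc-x-or-y v (inj₂ refl) rewrite inc-xy v | ==-refl v | ≢⇒==false {a = x} {b = v} x≢y = refl

    inc-end : ∀ s → inc (end s) e ≡ 1
    inc-end s = inc-x-or-y (end s) (end-is-x-or-y s)

    end-unique : ∀ s v → 0 < inc v e → side v ≡ s → v ≡ end s
    end-unique s v pos sv with incident⇒x-or-y v pos | end-is-x-or-y s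
    ... | inj₁ v≡x | inj₁ end≡x = trans v≡x (sym end≡x)
    ... | inj₂ v≡y | inj₂ end≡y = trans v≡y (sym end≡y)
    ... | inj₁ v≡x | inj₂ end≡y =
      contradiction (trans (cong side (sym v≡x)) (trans sv (trans (sym (end-side s)) (cong side end≡y)))) sides
    ... | inj₂ v≡y | inj₁ end≡x =
      contradiction (trans (cong side (sym end≡x)) (trans (end-side s) (trans (sym sv) (cong side v≡y)))) sides

    fV-end : ∀ s → fV (end s) ≡ a₀
    fV-end s with end-is-x-or-y s
    ... | inj₁ end≡x = trans (cong fV end≡x) fx
    ... | inj₂ end≡y = trans (cong fV end≡y) fy

  open Ends

  incOver : VG → Fin (nE H) → EG → ℕ
  incOver v h e′ = b2n (fE e′ == h) * inc v e′

  incOver-total : ∀ v h → sumFin (nE G) (incOver v h) ≡ into U (fV v) allV (shape H h)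
  incOver-total v h = trans (sumFin-cong (nE G) (λ e′ → sym (if-then-0 (fE e′ == h) (inc v e′)))) (local v h)

  incOver-loop : ∀ x h a₀ → shape H h ≡ uloop a₀ → fV x ≡ a₀ → sumFin (nE G) (incOver x h) ≡ 2
  incOver-loop x h a₀ sh fx = begin
    sumFin (nE G) (incOver x h)      ≡⟨ incOver-total x h ⟩
    into U (fV x) allV (shape H h)   ≡⟨ cong (into U (fV x) allV) sh ⟩
    2 * b2n ((a₀ == fV x) ∧ true)    ≡⟨ cong (λ b → 2 * b2n b) (trans (∧-identityʳ _) (trans (cong (a₀ ==_) fx) (==-refl a₀))) ⟩
    2 ∎
    where open ≡-Reasoning

  incOver-self : ∀ {e} (d : OverLoop e) s → incOver (end d s) (fE e) e ≡ 1
  incOver-self {e} d s rewrite ==-refl (fE e) = trans (+-identityʳ _) (inc-end d s)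

  incOver-end : ∀ {e} (d : OverLoop e) s → sumFin (nE G) (incOver (end d s) (fE e)) ≡ 2
  incOver-end {e} d s = incOver-loop (end d s) (fE e) a₀ shapeH (fV-end d s)
    where open LoopLift (loopLift e d)

  incOver-pos : ∀ v {h e′} → fE e′ ≡ h → 0 < inc v e′ → 1 ≤ incOver v h e′
  incOver-pos v {e′ = e′} refl pos rewrite ==-refl (fE e′) = subst (1 ≤_) (sym (+-identityʳ _)) pos

  Sibling : Bool → EG → EG → Set
  Sibling s e e′ = e′ ≢ e × fE e′ ≡ fE e × 0 < inc (endOnSide s (shape G e)) e′

  sibling-exists : ∀ {e} (d : OverLoop e) s → ∃ (Sibling s e)
  sibling-exists {e} d s with sumFin-positive (nE G) _ others-pos
    where
    others-pos : 0 < sumFin∖ (nE G) e (incOver (end d s) (fE e))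
    others-pos = subst (0 <_) (sym (+-cancelˡ-≡ 1 _ 1
                   (trans (cong (_+ sumFin∖ (nE G) e (incOver (end d s) (fE e))) (sym (incOver-self d s)))
                          (trans (sym (sumFin-split (nE G) e _)) (incOver-end d s)))))
                 (s≤s z≤n)
  ... | e′ , pos with b2n-pos (not (e′ == e)) _ pos
  ...   | e′≠e , pos′ with b2n-pos (fE e′ == fE e) _ pos′
  ...     | same-image , incident = e′ , e′≢e , ==⇒≡ same-image , incident
    where
    e′≢e : e′ ≢ e
    e′≢e refl = contradiction (trans (sym e′≠e) (cong not (==-refl e))) λ ()

  sibling-unique : ∀ {e} (d : OverLoop e) s e₁ e₂ → Sibling s e e₁ → Sibling s e e₂ → e₁ ≡ e₂
  sibling-unique {e} d s e₁ e₂ (e₁≢e , f₁ , i₁) (e₂≢e , f₂ , i₂) with e₁ ≟ e₂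
  ... | yes e₁≡e₂ = e₁≡e₂
  ... | no  e₁≢e₂ = contradiction (incOver-end d s) (λ sum≡2 → <-irrefl refl (≤-trans three≤sum (≤-reflexive sum≡2)))
    where
    three≤sum : 3 ≤ sumFin (nE G) (incOver (end d s) (fE e))
    three≤sum = ≤-trans (+-mono-≤ (≤-reflexive (sym (incOver-self d s)))
                                  (+-mono-≤ (incOver-pos _ f₁ i₁) (incOver-pos _ f₂ i₂)))
                        (three-terms≤sumFin (nE G) _ (λ e≡e₁ → e₁≢e (sym e≡e₁)) (λ e≡e₂ → e₂≢e (sym e≡e₂)) e₁≢e₂)

  private
    sibling? : ∀ s e → Dec (∃ (Sibling s e))
    sibling? s e = any? λ e′ → ¬? (e′ ≟ e) ×-dec ((fE e′ ≟ fE e) ×-dec (0 <? inc (endOnSide s (shape G e)) e′))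

    pick : ∀ s e → Dec (∃ (Sibling s e)) → EG
    pick s e (yes (e′ , _)) = e′
    pick s e (no _)         = e

    pick-sibling : ∀ s e (d : Dec (∃ (Sibling s e))) → ∃ (Sibling s e) → Sibling s e (pick s e d)
    pick-sibling s e (yes (_ , p)) _ = p
    pick-sibling s e (no none)     p = contradiction p none

  flip : Bool → EG → EG
  flip s e = if isULoop (shape H (fE e)) then pick s e (sibling? s e) else e

  flip-sibling : ∀ {e} (d : OverLoop e) s → Sibling s e (flip s e)
  flip-sibling {e} d s rewrite d = pick-sibling s e (sibling? s e) (sibling-exists d s)

  flip-OverLoop : ∀ {e} (d : OverLoop e) s → OverLoop (flip s e)
  flip-OverLoop d s = trans (cong (λ h → isULoop (shape H h)) (proj₁ (proj₂ (flip-sibling d s)))) d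

  flip-no-fixpoint : ∀ {e} (d : OverLoop e) s → flip s e ≢ e
  flip-no-fixpoint d s = proj₁ (flip-sibling d s)

  flip-off-loop : ∀ s {e} → isULoop (shape H (fE e)) ≡ false → flip s e ≡ e
  flip-off-loop s off rewrite off = refl

  flip-involutive : ∀ s e → flip s (flip s e) ≡ e
  flip-involutive s e = by-cases (isULoop (shape H (fE e))) refl
    where
    by-cases : ∀ b → isULoop (shape H (fE e)) ≡ b → flip s (flip s e) ≡ e
    by-cases false off = trans (cong (flip s) (flip-off-loop s off)) (flip-off-loop s off)
    by-cases true  d   = sym (sibling-unique d′ s e (flip s e′) (e≢e′ , sym f-eq , incident) (flip-sibling d′ s))
      where
      e′ : EG
      e′ = flip s e
      sib : Sibling s e e′
      sib = flip-sibling d s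
      f-eq : fE e′ ≡ fE e
      f-eq = proj₁ (proj₂ sib)
      d′ : OverLoop e′
      d′ = flip-OverLoop d s
      e≢e′ : e ≢ e′
      e≢e′ e≡e′ = proj₁ sib (sym e≡e′)
      same-end : end d s ≡ end d′ s
      same-end = end-unique d′ s (end d s) (proj₂ (proj₂ sib)) (end-side d s)
      incident : 0 < inc (end d′ s) e
      incident = subst (λ v → 0 < inc v e) same-end (subst (0 <_) (sym (inc-end d s)) (s≤s z≤n))

  private
    module Colouring = AlternatingColouring (nE G) (flip true) (flip false)
                         (flip-involutive true) (flip-involutive false) OverLoop
                         (λ d → flip-OverLoop d true) (λ d → flip-OverLoop d false)
                         (λ d → flip-no-fixpoint d true) (λ d → flip-no-fixpoint d false)

  loopColour : EG → Bool
  loopColour = Colouring.colour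

  loopColour-flip : ∀ {e} → OverLoop e → ∀ s → loopColour (flip s e) ≡ not (loopColour e)
  loopColour-flip d true  = Colouring.colour-a d
  loopColour-flip d false = Colouring.colour-b d

  incColour : VG → Fin (nE H) → Bool → EG → ℕ
  incColour x h c e′ = b2n ((fE e′ == h) ∧ (loopColour e′ ==ᴮ c)) * inc x e′

  private
    ∧-==ᴮ-split : (p b c : Bool) → b2n (p ∧ (b ==ᴮ c)) + b2n (p ∧ (b ==ᴮ not c)) ≡ b2n p
    ∧-==ᴮ-split false b     c     = refl
    ∧-==ᴮ-split true  true  true  = refl
    ∧-==ᴮ-split true  true  false = refl
    ∧-==ᴮ-split true  false true  = refl
    ∧-==ᴮ-split true  false false = refl

    both-1 : ∀ {m n} → m + n ≡ 2 → 1 ≤ m → 1 ≤ n → m ≡ 1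
    both-1 {suc zero} _ _ _ = refl
    both-1 {suc (suc m)} {suc n} eq _ _ with trans (sym (+-suc (suc (suc m)) n)) eq
    ... | ()

  incColour-split : ∀ x h c → sumFin (nE G) (incColour x h c) + sumFin (nE G) (incColour x h (not c))
                              ≡ sumFin (nE G) (incOver x h)
  incColour-split x h c = trans (sym (sumFin-+ (nE G) _ _)) (sumFin-cong (nE G) split)
    where
    split : ∀ e′ → incColour x h c e′ + incColour x h (not c) e′ ≡ incOver x h e′
    split e′ = trans (sym (*-distribʳ-+ (inc x e′) (b2n ((fE e′ == h) ∧ (loopColour e′ ==ᴮ c)))
                                                   (b2n ((fE e′ == h) ∧ (loopColour e′ ==ᴮ not c)))))
                     (cong (_* inc x e′) (∧-==ᴮ-split (fE e′ == h) (loopColour e′) c))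

  incColour-pos : ∀ x h c {e′} → fE e′ ≡ h → 0 < inc x e′ → loopColour e′ ≡ c → 1 ≤ incColour x h c e′
  incColour-pos x h c {e′} refl pos refl rewrite ==-refl (fE e′) | ==ᴮ-refl (loopColour e′) =
    subst (1 ≤_) (sym (+-identityʳ _)) pos

  -- both colours occur at x: on an edge there over h and on its flip
  both-colours : ∀ x h a₀ → shape H h ≡ uloop a₀ → fV x ≡ a₀ → ∀ c → 1 ≤ sumFin (nE G) (incColour x h c)
  both-colours x h a₀ sh fx c with sumFin-positive (nE G) (incOver x h)
                                     (subst (0 <_) (sym (incOver-loop x h a₀ sh fx)) (s≤s z≤n))
  ... | e₁ , pos with b2n-pos (fE e₁ == h) _ pos
  ...   | f₁ , i₁ with bool-cases (loopColour e₁) c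
    where
    bool-cases : ∀ b c → c ≡ b ⊎ c ≡ not b
    bool-cases true  true  = inj₁ refl
    bool-cases true  false = inj₂ refl
    bool-cases false false = inj₁ refl
    bool-cases false true  = inj₂ refl
  ... | inj₁ c≡col₁ = ≤-trans (incColour-pos x h c (==⇒≡ f₁) i₁ (sym c≡col₁)) (term≤sumFin (nE G) e₁ _)
  ... | inj₂ c≡¬col₁ = ≤-trans (incColour-pos x h c fE-e₂ i₂ col₂) (term≤sumFin (nE G) e₂ _)
    where
    d₁ : OverLoop e₁
    d₁ = trans (cong (λ h′ → isULoop (shape H h′)) (==⇒≡ f₁)) (cong isULoop sh)
    e₂ : EG
    e₂ = flip (side x) e₁
    fE-e₂ : fE e₂ ≡ h
    fE-e₂ = trans (proj₁ (proj₂ (flip-sibling d₁ (side x)))) (==⇒≡ f₁)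
    i₂ : 0 < inc x e₂
    i₂ = subst (λ v → 0 < inc v e₂) (sym (end-unique d₁ (side x) x i₁ refl)) (proj₂ (proj₂ (flip-sibling d₁ (side x))))
    col₂ : loopColour e₂ ≡ c
    col₂ = trans (loopColour-flip d₁ (side x)) (sym c≡¬col₁)

  loopColour-balanced : ∀ x h a₀ → shape H h ≡ uloop a₀ → fV x ≡ a₀ → ∀ c →
    sumFin (nE G) (λ e′ → b2n ((fE e′ == h) ∧ (loopColour e′ ==ᴮ c)) * inc x e′) ≡ 1
  loopColour-balanced x h a₀ sh fx c =
    both-1 (trans (incColour-split x h c) (incOver-loop x h a₀ sh fx))
           (both-colours x h a₀ sh fx c) (both-colours x h a₀ sh fx (not c))

-- The key of a slot of an edge: its shape up to orientation of undirected edges, where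
-- halfK stands for a semi-edge or for one half of an undirected loop.
data SlotKey (n : ℕ) : Set where
  undirK dirK                   : Fin n → Fin n → SlotKey n
  uloopK dloopK semiK halfK     : Fin n → SlotKey n

infix 5 _==ᵏ_
infix 4 _≈ᵏ_

_==ᵏ_ : {n : ℕ} → SlotKey n → SlotKey n → Bool
undirK a b ==ᵏ undirK c d = ((a == c) ∧ (b == d)) ∨ ((a == d) ∧ (b == c))
dirK a b   ==ᵏ dirK c d   = (a == c) ∧ (b == d)
uloopK a   ==ᵏ uloopK c   = a == c
dloopK a   ==ᵏ dloopK c   = a == c
semiK a    ==ᵏ semiK c    = a == c
halfK a    ==ᵏ halfK c    = a == c
_          ==ᵏ _          = false

data _≈ᵏ_ {n : ℕ} : SlotKey n → SlotKey n → Set where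
  undir-≈ : ∀ {a b} → undirK a b ≈ᵏ undirK a b
  undir-↔ : ∀ {a b} → undirK a b ≈ᵏ undirK b a
  dir-≈   : ∀ {a b} → dirK a b ≈ᵏ dirK a b
  uloop-≈ : ∀ {a} → uloopK a ≈ᵏ uloopK a
  dloop-≈ : ∀ {a} → dloopK a ≈ᵏ dloopK a
  semi-≈  : ∀ {a} → semiK a ≈ᵏ semiK a
  half-≈  : ∀ {a} → halfK a ≈ᵏ halfK a

private
  ∨-true : ∀ {p q} → p ∨ q ≡ true → p ≡ true ⊎ q ≡ true
  ∨-true {true}  _ = inj₁ refl
  ∨-true {false} e = inj₂ e

==ᵏ⇒≈ᵏ : {n : ℕ} (s t : SlotKey n) → s ==ᵏ t ≡ true → s ≈ᵏ t
==ᵏ⇒≈ᵏ (undirK a b) (undirK c d) e with ∨-true {(a == c) ∧ (b == d)} e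
... | inj₁ p with ∧-true {a == c} p
...   | a=c , b=d rewrite ==⇒≡ a=c | ==⇒≡ b=d = undir-≈
==ᵏ⇒≈ᵏ (undirK a b) (undirK c d) e | inj₂ p with ∧-true {a == d} p
...   | a=d , b=c rewrite ==⇒≡ a=d | ==⇒≡ b=c = undir-↔
==ᵏ⇒≈ᵏ (dirK a b) (dirK c d) e with ∧-true {a == c} e
... | a=c , b=d rewrite ==⇒≡ a=c | ==⇒≡ b=d = dir-≈
==ᵏ⇒≈ᵏ (uloopK a) (uloopK c) e rewrite ==⇒≡ e = uloop-≈
==ᵏ⇒≈ᵏ (dloopK a) (dloopK c) e rewrite ==⇒≡ e = dloop-≈
==ᵏ⇒≈ᵏ (semiK a)  (semiK c)  e rewrite ==⇒≡ e = semi-≈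
==ᵏ⇒≈ᵏ (halfK a)  (halfK c)  e rewrite ==⇒≡ e = half-≈

≈ᵏ⇒==ᵏ : {n : ℕ} {s t : SlotKey n} → s ≈ᵏ t → s ==ᵏ t ≡ true
≈ᵏ⇒==ᵏ (undir-≈ {a} {b}) rewrite ==-refl a | ==-refl b = refl
≈ᵏ⇒==ᵏ (undir-↔ {a} {b}) rewrite ==-refl a | ==-refl b = ∨-zeroʳ _
≈ᵏ⇒==ᵏ (dir-≈ {a} {b})   rewrite ==-refl a | ==-refl b = refl
≈ᵏ⇒==ᵏ (uloop-≈ {a}) = ==-refl a
≈ᵏ⇒==ᵏ (dloop-≈ {a}) = ==-refl a
≈ᵏ⇒==ᵏ (semi-≈ {a})  = ==-refl a
≈ᵏ⇒==ᵏ (half-≈ {a})  = ==-refl a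

≈ᵏ-refl : {n : ℕ} (s : SlotKey n) → s ≈ᵏ s
≈ᵏ-refl (undirK a b) = undir-≈
≈ᵏ-refl (dirK a b)   = dir-≈
≈ᵏ-refl (uloopK a)   = uloop-≈
≈ᵏ-refl (dloopK a)   = dloop-≈
≈ᵏ-refl (semiK a)    = semi-≈
≈ᵏ-refl (halfK a)    = half-≈

≈ᵏ-sym : {n : ℕ} {s t : SlotKey n} → s ≈ᵏ t → t ≈ᵏ s
≈ᵏ-sym undir-≈ = undir-≈
≈ᵏ-sym undir-↔ = undir-↔
≈ᵏ-sym dir-≈   = dir-≈
≈ᵏ-sym uloop-≈ = uloop-≈
≈ᵏ-sym dloop-≈ = dloop-≈
≈ᵏ-sym semi-≈  = semi-≈
≈ᵏ-sym half-≈  = half-≈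

≈ᵏ-trans : {n : ℕ} {s t u : SlotKey n} → s ≈ᵏ t → t ≈ᵏ u → s ≈ᵏ u
≈ᵏ-trans undir-≈ r       = r
≈ᵏ-trans undir-↔ undir-≈ = undir-↔
≈ᵏ-trans undir-↔ undir-↔ = undir-≈
≈ᵏ-trans dir-≈   r       = r
≈ᵏ-trans uloop-≈ r       = r
≈ᵏ-trans dloop-≈ r       = r
≈ᵏ-trans semi-≈  r       = r
≈ᵏ-trans half-≈  r       = r

==ᵏ-refl : {n : ℕ} (s : SlotKey n) → s ==ᵏ s ≡ true
==ᵏ-refl s = ≈ᵏ⇒==ᵏ (≈ᵏ-refl s)

==ᵏ-trans : {n : ℕ} (s t u : SlotKey n) → s ==ᵏ t ≡ true → t ==ᵏ u ≡ true → s ==ᵏ u ≡ true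
==ᵏ-trans s t u e₁ e₂ = ≈ᵏ⇒==ᵏ (≈ᵏ-trans (==ᵏ⇒≈ᵏ s t e₁) (==ᵏ⇒≈ᵏ t u e₂))

==ᵏ-sym : {n : ℕ} (s t : SlotKey n) → s ==ᵏ t ≡ t ==ᵏ s
==ᵏ-sym s t = true⇔true⇒≡ (λ e → ≈ᵏ⇒==ᵏ (≈ᵏ-sym (==ᵏ⇒≈ᵏ s t e)))
                          (λ e → ≈ᵏ⇒==ᵏ (≈ᵏ-sym (==ᵏ⇒≈ᵏ t s e)))

mapKey : {n : ℕ} → (Fin n → Fin n) → SlotKey n → SlotKey n
mapKey f (undirK a b) = undirK (f a) (f b)
mapKey f (dirK a b)   = dirK (f a) (f b)
mapKey f (uloopK a)   = uloopK (f a)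
mapKey f (dloopK a)   = dloopK (f a)
mapKey f (semiK a)    = semiK (f a)
mapKey f (halfK a)    = halfK (f a)

mapKey-≈ᵏ : {n : ℕ} (f : Fin n → Fin n) {s t : SlotKey n} → s ≈ᵏ t → mapKey f s ≈ᵏ mapKey f t
mapKey-≈ᵏ f undir-≈ = undir-≈
mapKey-≈ᵏ f undir-↔ = undir-↔
mapKey-≈ᵏ f dir-≈   = dir-≈
mapKey-≈ᵏ f uloop-≈ = uloop-≈
mapKey-≈ᵏ f dloop-≈ = dloop-≈
mapKey-≈ᵏ f semi-≈  = semi-≈
mapKey-≈ᵏ f half-≈  = half-≈

mapKey-involutive : {n : ℕ} (f : Fin n → Fin n) → (∀ a → f (f a) ≡ a) → ∀ s → mapKey f (mapKey f s) ≡ s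
mapKey-involutive f inv (undirK a b) = cong₂ undirK (inv a) (inv b)
mapKey-involutive f inv (dirK a b)   = cong₂ dirK (inv a) (inv b)
mapKey-involutive f inv (uloopK a)   = cong uloopK (inv a)
mapKey-involutive f inv (dloopK a)   = cong dloopK (inv a)
mapKey-involutive f inv (semiK a)    = cong semiK (inv a)
mapKey-involutive f inv (halfK a)    = cong halfK (inv a)

==ᵏ-mapKey : {n : ℕ} (f : Fin n → Fin n) → (∀ a → f (f a) ≡ a) →
             ∀ s t → mapKey f s ==ᵏ mapKey f t ≡ s ==ᵏ t
==ᵏ-mapKey f inv s t = true⇔true⇒≡
  (λ e → subst₂ (λ s′ t′ → s′ ==ᵏ t′ ≡ true) (mapKey-involutive f inv s) (mapKey-involutive f inv t)
           (≈ᵏ⇒==ᵏ (mapKey-≈ᵏ f (==ᵏ⇒≈ᵏ (mapKey f s) (mapKey f t) e))))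
  (λ e → ≈ᵏ⇒==ᵏ (mapKey-≈ᵏ f (==ᵏ⇒≈ᵏ s t e)))

slotInc : {n : ℕ} → Kind → Fin n → SlotKey n → ℕ
slotInc U v (undirK a b) = b2n (a == v) + b2n (b == v)
slotInc O v (dirK a b)   = b2n (a == v)
slotInc I v (dirK a b)   = b2n (b == v)
slotInc U v (uloopK a)   = 2 * b2n (a == v)
slotInc O v (dloopK a)   = b2n (a == v)
slotInc I v (dloopK a)   = b2n (a == v)
slotInc U v (semiK a)    = b2n (a == v)
slotInc U v (halfK a)    = b2n (a == v)
slotInc _ _ _            = 0

slotInc-≈ᵏ : {n : ℕ} (k : Kind) (v : Fin n) {s t : SlotKey n} → s ≈ᵏ t → slotInc k v s ≡ slotInc k v t
slotInc-≈ᵏ U v (undir-↔ {a} {b}) = +-comm (b2n (a == v)) (b2n (b == v))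
slotInc-≈ᵏ O v undir-↔ = refl
slotInc-≈ᵏ I v undir-↔ = refl
slotInc-≈ᵏ k v undir-≈ = refl
slotInc-≈ᵏ k v dir-≈   = refl
slotInc-≈ᵏ k v uloop-≈ = refl
slotInc-≈ᵏ k v dloop-≈ = refl
slotInc-≈ᵏ k v semi-≈  = refl
slotInc-≈ᵏ k v half-≈  = refl

module _ {n : ℕ} (f : Fin n → Fin n) (f-inj : ∀ {x y} → f x ≡ f y → x ≡ y) where

  private
    b2n-== : ∀ a v → b2n (f a == f v) ≡ b2n (a == v)
    b2n-== a v = cong b2n (==-injective f f-inj a v)

  slotInc-mapKey : (k : Kind) (v : Fin n) (s : SlotKey n) → slotInc k (f v) (mapKey f s) ≡ slotInc k v s
  slotInc-mapKey U v (undirK a b) = cong₂ _+_ (b2n-== a v) (b2n-== b v)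
  slotInc-mapKey O v (undirK a b) = refl
  slotInc-mapKey I v (undirK a b) = refl
  slotInc-mapKey U v (dirK a b)   = refl
  slotInc-mapKey O v (dirK a b)   = b2n-== a v
  slotInc-mapKey I v (dirK a b)   = b2n-== b v
  slotInc-mapKey U v (uloopK a)   = cong (2 *_) (b2n-== a v)
  slotInc-mapKey O v (uloopK a)   = refl
  slotInc-mapKey I v (uloopK a)   = refl
  slotInc-mapKey U v (dloopK a)   = refl
  slotInc-mapKey O v (dloopK a)   = b2n-== a v
  slotInc-mapKey I v (dloopK a)   = b2n-== a v
  slotInc-mapKey U v (semiK a)    = b2n-== a v
  slotInc-mapKey O v (semiK a)    = refl
  slotInc-mapKey I v (semiK a)    = refl
  slotInc-mapKey U v (halfK a)    = b2n-== a v
  slotInc-mapKey O v (halfK a)    = refl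
  slotInc-mapKey I v (halfK a)    = refl

-- With halves = true an undirected loop consists of two slots, each worth a semi-edge.
keyOf : {n : ℕ} → Bool → Shape (Fin n) → SlotKey n
keyOf halves (undir a b) = undirK a b
keyOf halves (dir a b)   = dirK a b
keyOf true   (uloop a)   = halfK a
keyOf false  (uloop a)   = uloopK a
keyOf halves (dloop a)   = dloopK a
keyOf true   (semi a)    = halfK a
keyOf false  (semi a)    = semiK a

slots : {n : ℕ} → Bool → Shape (Fin n) → ℕ
slots halves s = 1 + b2n (isULoop s ∧ halves)

into-slots : {n : ℕ} (halves : Bool) (k : Kind) (v : Fin n) (s : Shape (Fin n)) →
             into k v allV s ≡ slots halves s * slotInc k v (keyOf halves s)
into-slots halves U v (undir a b) =
  trans (cong₂ _+_ (cong b2n (∧-identityʳ (a == v))) (cong b2n (∧-identityʳ (b == v)))) (sym (+-identityʳ _))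
into-slots halves O v (undir a b) = refl
into-slots halves I v (undir a b) = refl
into-slots halves U v (dir a b)   = refl
into-slots halves O v (dir a b)   = trans (cong b2n (∧-identityʳ (a == v))) (sym (+-identityʳ _))
into-slots halves I v (dir a b)   = trans (cong b2n (∧-identityʳ (b == v))) (sym (+-identityʳ _))
into-slots true   U v (uloop a)   = cong (λ z → b2n z + (b2n z + 0)) (∧-identityʳ (a == v))
into-slots false  U v (uloop a)   = trans (cong (λ z → 2 * b2n z) (∧-identityʳ (a == v))) (sym (+-identityʳ _))
into-slots true   O v (uloop a)   = refl
into-slots false  O v (uloop a)   = refl
into-slots true   I v (uloop a)   = refl
into-slots false  I v (uloop a)   = refl
into-slots halves U v (dloop a)   = refl
into-slots halves O v (dloop a)   = trans (cong b2n (∧-identityʳ (a == v))) (sym (+-identityʳ _))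
into-slots halves I v (dloop a)   = trans (cong b2n (∧-identityʳ (a == v))) (sym (+-identityʳ _))
into-slots true   U v (semi a)    = trans (cong b2n (∧-identityʳ (a == v))) (sym (+-identityʳ _))
into-slots false  U v (semi a)    = trans (cong b2n (∧-identityʳ (a == v))) (sym (+-identityʳ _))
into-slots true   O v (semi a)    = refl
into-slots false  O v (semi a)    = refl
into-slots true   I v (semi a)    = refl
into-slots false  I v (semi a)    = refl

slotsKeyed : {n : ℕ} → Bool → SlotKey n → Shape (Fin n) → ℕ
slotsKeyed halves t s = slots halves s * b2n (keyOf halves s ==ᵏ t)

uloopAt : {n : ℕ} → Fin n → Shape (Fin n) → ℕ
uloopAt a (uloop x) = b2n (x == a)
uloopAt a _         = 0

private
  ∧-== : {n : ℕ} {a b : Fin n} (x : Fin n) → a ≢ b → b2n ((x == a) ∧ (x == b)) ≡ 0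
  ∧-== {a = a} {b} x a≢b with ==-view x a
  ... | distinct _ x=a rewrite x=a = refl
  ... | equal refl x=a rewrite x=a | ≢⇒==false a≢b = refl

  ∧-==′ : {n : ℕ} {x y : Fin n} (a : Fin n) → x ≢ y → b2n ((x == a) ∧ (y == a)) ≡ 0
  ∧-==′ {x = x} {y} a x≢y with ==-view x a
  ... | distinct _ x=a rewrite x=a = refl
  ... | equal refl x=a rewrite x=a | ≢⇒==false {a = y} {b = x} (λ y≡x → x≢y (sym y≡x)) = refl

  ∨-exclusive : (P Q R S : Bool) → (P ≡ true → R ≡ true → ⊥) → (Q ≡ true → S ≡ true → ⊥) →
                b2n ((P ∧ Q) ∨ (R ∧ S)) ≡ b2n (P ∧ Q) + b2n (S ∧ R)
  ∨-exclusive true  true  true  true  h _ = contradiction refl (h refl)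
  ∨-exclusive true  true  true  false h _ = contradiction refl (h refl)
  ∨-exclusive true  true  false true  _ h = contradiction refl (h refl)
  ∨-exclusive true  true  false false _ _ = refl
  ∨-exclusive true  false true  true  h _ = contradiction refl (h refl)
  ∨-exclusive true  false true  false h _ = contradiction refl (h refl)
  ∨-exclusive true  false false true  _ _ = refl
  ∨-exclusive true  false false false _ _ = refl
  ∨-exclusive false true  true  true  _ h = contradiction refl (h refl)
  ∨-exclusive false true  true  false _ _ = refl
  ∨-exclusive false true  false true  _ h = contradiction refl (h refl)
  ∨-exclusive false true  false false _ _ = refl
  ∨-exclusive false false true  true  _ _ = refl
  ∨-exclusive false false true  false _ _ = refl
  ∨-exclusive false false false true  _ _ = refl
  ∨-exclusive false false false false _ _ = refl

slotsKeyed-undir : {n : ℕ} (halves : Bool) {a b : Fin n} → a ≢ b → (s : Shape (Fin n)) → Normal s →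
                   slotsKeyed halves (undirK a b) s ≡ into U a (_== b) s
slotsKeyed-undir halves {a} {b} a≢b (undir x y) _ =
  trans (+-identityʳ _) (∨-exclusive (x == a) (y == b) (x == b) (y == a)
    (λ p q → a≢b (trans (sym (==⇒≡ p)) (==⇒≡ q)))
    (λ p q → a≢b (trans (sym (==⇒≡ q)) (==⇒≡ p))))
slotsKeyed-undir halves a≢b (dir x y) _ = refl
slotsKeyed-undir true   a≢b (uloop x) _ = sym (cong (2 *_) (∧-== x a≢b))
slotsKeyed-undir false  a≢b (uloop x) _ = sym (cong (2 *_) (∧-== x a≢b))
slotsKeyed-undir halves a≢b (dloop x) _ = refl
slotsKeyed-undir true   a≢b (semi x)  _ = sym (∧-== x a≢b)
slotsKeyed-undir false  a≢b (semi x)  _ = sym (∧-== x a≢b)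

slotsKeyed-dir : {n : ℕ} (halves : Bool) {a b : Fin n} → a ≢ b → (s : Shape (Fin n)) →
                 slotsKeyed halves (dirK a b) s ≡ into O a (_== b) s
slotsKeyed-dir halves a≢b (undir x y) = refl
slotsKeyed-dir halves a≢b (dir x y)   = +-identityʳ _
slotsKeyed-dir true   a≢b (uloop x)   = refl
slotsKeyed-dir false  a≢b (uloop x)   = refl
slotsKeyed-dir halves a≢b (dloop x)   = sym (∧-== x a≢b)
slotsKeyed-dir true   a≢b (semi x)    = refl
slotsKeyed-dir false  a≢b (semi x)    = refl

slotsKeyed-dloop : {n : ℕ} (halves : Bool) (a : Fin n) (s : Shape (Fin n)) → Normal s →
                   slotsKeyed halves (dloopK a) s ≡ into O a (_== a) s
slotsKeyed-dloop halves a (undir x y) _   = refl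
slotsKeyed-dloop halves a (dir x y)   x≢y = sym (∧-==′ a x≢y)
slotsKeyed-dloop true   a (uloop x)   _   = refl
slotsKeyed-dloop false  a (uloop x)   _   = refl
slotsKeyed-dloop halves a (dloop x)   _   = trans (+-identityʳ _) (cong b2n (sym (∧-idem (x == a))))
slotsKeyed-dloop true   a (semi x)    _   = refl
slotsKeyed-dloop false  a (semi x)    _   = refl

slotsKeyed-half : {n : ℕ} (a : Fin n) (s : Shape (Fin n)) → Normal s →
                  slotsKeyed true (halfK a) s ≡ into U a (_== a) s
slotsKeyed-half a (undir x y) x≢y = sym (cong₂ _+_ (∧-==′ a x≢y) (∧-==′ a (λ y≡x → x≢y (sym y≡x))))
slotsKeyed-half a (dir x y)   _   = refl
slotsKeyed-half a (uloop x)   _   = cong (λ z → 2 * b2n z) (sym (∧-idem (x == a)))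
slotsKeyed-half a (dloop x)   _   = refl
slotsKeyed-half a (semi x)    _   = trans (+-identityʳ _) (cong b2n (sym (∧-idem (x == a))))

slotsKeyed-uloop : {n : ℕ} (a : Fin n) (s : Shape (Fin n)) → slotsKeyed false (uloopK a) s ≡ uloopAt a s
slotsKeyed-uloop a (undir x y) = refl
slotsKeyed-uloop a (dir x y)   = refl
slotsKeyed-uloop a (uloop x)   = +-identityʳ _
slotsKeyed-uloop a (dloop x)   = refl
slotsKeyed-uloop a (semi x)    = refl

slotsKeyed-semi : {n : ℕ} (a : Fin n) (s : Shape (Fin n)) → slotsKeyed false (semiK a) s ≡ isSemiAt a s
slotsKeyed-semi a (undir x y) = refl
slotsKeyed-semi a (dir x y)   = refl
slotsKeyed-semi a (uloop x)   = refl
slotsKeyed-semi a (dloop x)   = refl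
slotsKeyed-semi a (semi x)    = +-identityʳ _

into-self : {n : ℕ} (a : Fin n) (s : Shape (Fin n)) → Normal s →
            into U a (_== a) s ≡ 2 * uloopAt a s + isSemiAt a s
into-self a (undir x y) x≢y = cong₂ _+_ (∧-==′ a x≢y) (∧-==′ a (λ y≡x → x≢y (sym y≡x)))
into-self a (dir x y)   _   = refl
into-self a (uloop x)   _   = trans (cong (λ z → 2 * b2n z) (∧-idem (x == a))) (sym (+-identityʳ _))
into-self a (dloop x)   _   = refl
into-self a (semi x)    _   = cong b2n (∧-idem (x == a))

Moved : {n : ℕ} → Bool → (Fin n → Fin n) → Shape (Fin n) → Shape (Fin n) → Set
Moved halves σ (undir a b) sh′ = sh′ ≡ undir (σ a) (σ b) ⊎ sh′ ≡ undir (σ b) (σ a)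
Moved halves σ (dir a b)   sh′ = sh′ ≡ dir (σ a) (σ b)
Moved true   σ (uloop a)   sh′ = sh′ ≡ uloop (σ a) ⊎ sh′ ≡ semi (σ a)
Moved false  σ (uloop a)   sh′ = sh′ ≡ uloop (σ a)
Moved halves σ (dloop a)   sh′ = sh′ ≡ dloop (σ a)
Moved true   σ (semi a)    sh′ = sh′ ≡ uloop (σ a) ⊎ sh′ ≡ semi (σ a)
Moved false  σ (semi a)    sh′ = sh′ ≡ semi (σ a)

moved-from-key : {n : ℕ} (halves : Bool) (σ : Fin n → Fin n) (sh sh′ : Shape (Fin n)) →
                 keyOf halves sh′ ≈ᵏ mapKey σ (keyOf halves sh) → Moved halves σ sh sh′
moved-from-key h     σ (undir a b) (undir c d) undir-≈ = inj₁ refl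
moved-from-key h     σ (undir a b) (undir c d) undir-↔ = inj₂ refl
moved-from-key h     σ (dir a b)   (dir c d)   dir-≈   = refl
moved-from-key h     σ (dloop a)   (dloop c)   dloop-≈ = refl
moved-from-key true  σ (uloop a)   (uloop c)   half-≈  = inj₁ refl
moved-from-key true  σ (uloop a)   (semi c)    half-≈  = inj₂ refl
moved-from-key true  σ (semi a)    (uloop c)   half-≈  = inj₁ refl
moved-from-key true  σ (semi a)    (semi c)    half-≈  = inj₂ refl
moved-from-key false σ (uloop a)   (uloop c)   uloop-≈ = refl
moved-from-key false σ (semi a)    (semi c)    semi-≈  = refl
moved-from-key true  σ (undir a b) (uloop c) ()
moved-from-key false σ (undir a b) (uloop c) ()
moved-from-key true  σ (undir a b) (semi c)  ()
moved-from-key false σ (undir a b) (semi c)  ()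
moved-from-key true  σ (dir a b)   (uloop c) ()
moved-from-key false σ (dir a b)   (uloop c) ()
moved-from-key true  σ (dir a b)   (semi c)  ()
moved-from-key false σ (dir a b)   (semi c)  ()
moved-from-key true  σ (dloop a)   (uloop c) ()
moved-from-key false σ (dloop a)   (uloop c) ()
moved-from-key true  σ (dloop a)   (semi c)  ()
moved-from-key false σ (dloop a)   (semi c)  ()

Link : {n : ℕ} → Shape (Fin n) → Set
Link (undir _ _) = ⊤
Link (dir _ _)   = ⊤
Link _           = ⊥

module _ {m n : ℕ} (σ : Fin n → Fin n) {f f′ : Fin m → Fin n} (f′≡σf : ∀ x → f′ x ≡ σ (f x)) where

  private
    ↑σ : ∀ {x u} → f x ≡ u → f′ x ≡ σ u
    ↑σ {x} fx≡u = trans (f′≡σf x) (cong σ fx≡u)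

  -- With halves, an edge of G over an undirected loop or semi-edge is a link, so it may
  -- equally lie over either of them.
  ShapeOver-moved : (halves : Bool) (sg : Shape (Fin m)) (sh sh′ : Shape (Fin n)) →
    ShapeOver f sg sh → Moved halves σ sh sh′ → (halves ≡ true → Link sg) → ShapeOver f′ sg sh′
  ShapeOver-moved h     (undir x y) (undir a b) _ (inj₁ (p , q)) (inj₁ refl) _ = inj₁ (↑σ p , ↑σ q)
  ShapeOver-moved h     (undir x y) (undir a b) _ (inj₁ (p , q)) (inj₂ refl) _ = inj₂ (↑σ p , ↑σ q)
  ShapeOver-moved h     (undir x y) (undir a b) _ (inj₂ (p , q)) (inj₁ refl) _ = inj₂ (↑σ p , ↑σ q)
  ShapeOver-moved h     (undir x y) (undir a b) _ (inj₂ (p , q)) (inj₂ refl) _ = inj₁ (↑σ p , ↑σ q)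
  ShapeOver-moved true  (undir x y) (uloop a)   _ (p , q) (inj₁ refl) _ = ↑σ p , ↑σ q
  ShapeOver-moved true  (undir x y) (uloop a)   _ (p , q) (inj₂ refl) _ = ↑σ p , ↑σ q
  ShapeOver-moved false (undir x y) (uloop a)   _ (p , q) refl        _ = ↑σ p , ↑σ q
  ShapeOver-moved true  (undir x y) (semi a)    _ (p , q) (inj₁ refl) _ = ↑σ p , ↑σ q
  ShapeOver-moved true  (undir x y) (semi a)    _ (p , q) (inj₂ refl) _ = ↑σ p , ↑σ q
  ShapeOver-moved false (undir x y) (semi a)    _ (p , q) refl        _ = ↑σ p , ↑σ q
  ShapeOver-moved h     (dir x y)   (dir a b)   _ (p , q) refl        _ = ↑σ p , ↑σ q
  ShapeOver-moved h     (dir x y)   (dloop a)   _ (p , q) refl        _ = ↑σ p , ↑σ q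
  ShapeOver-moved h     (dloop x)   (dloop a)   _ p       refl        _ = ↑σ p
  ShapeOver-moved false (uloop x)   (uloop a)   _ p       refl        _ = ↑σ p
  ShapeOver-moved false (semi x)    (semi a)    _ p       refl        _ = ↑σ p
  ShapeOver-moved true  (uloop x)   (uloop a)   _ _       _           link with link refl
  ... | ()
  ShapeOver-moved true  (semi x)    (semi a)    _ _       _           link with link refl
  ... | ()

private
  ≡ᵇ-refl : ∀ n → (n ≡ᵇ n) ≡ true
  ≡ᵇ-refl n = Equivalence.to T-≡ (≡⇒≡ᵇ n n refl)

  ≡ᵇ-true : ∀ {m n} → (m ≡ᵇ n) ≡ true → m ≡ n
  ≡ᵇ-true {m} {n} e = ≡ᵇ⇒≡ m n (Equivalence.from T-≡ e)

  ≡ᵇ-sym : ∀ m n → (m ≡ᵇ n) ≡ (n ≡ᵇ m)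
  ≡ᵇ-sym m n = true⇔true⇒≡ (λ e → subst (λ k → (k ≡ᵇ m) ≡ true) (≡ᵇ-true {m} {n} e) (≡ᵇ-refl m))
                           (λ e → subst (λ k → (k ≡ᵇ n) ≡ true) (≡ᵇ-true {n} {m} e) (≡ᵇ-refl n))

-- Slots of H: every edge h has the slot (h , false); an undirected loop has a second
-- slot (h , true) when loops are halved.  Slots are matched with slots whose key is the
-- σ-image, which is possible because σ preserves the number of slots of every key.
module SlotMatching (H : Graph) {t : ℕ} (cls : Fin (nV H) → Fin t)
  (fibres≤2 : (u v w : Fin (nV H)) → cls u ≡ cls v → cls v ≡ cls w → u ≡ v ⊎ (v ≡ w ⊎ u ≡ w))
  (equitable : Equitable H cls)
  (halves : Bool)
  (semis-balanced : halves ≡ false → ∀ r g → cls r ≡ cls g → r ≢ g → ∀ α → semiCount H r α ≡ semiCount H g α)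
  where

  open MultiplicitySymmetry H cls fibres≤2 equitable public

  nSlots : ℕ
  nSlots = nE H + nE H

  slot : Fin (nE H) → Bool → Fin nSlots
  slot h false = h ↑ˡ nE H
  slot h true  = nE H ↑ʳ h

  unslot : Fin nSlots → Fin (nE H) × Bool
  unslot o = [ (λ h → h , false) , (λ h → h , true) ]′ (splitAt (nE H) o)

  slotEdge : Fin nSlots → Fin (nE H)
  slotEdge o = proj₁ (unslot o)

  slotHalf : Fin nSlots → Bool
  slotHalf o = proj₂ (unslot o)

  unslot-slot : ∀ h c → unslot (slot h c) ≡ (h , c)
  unslot-slot h false rewrite splitAt-↑ˡ (nE H) h (nE H) = refl
  unslot-slot h true  rewrite splitAt-↑ʳ (nE H) (nE H) h = refl

  slot-unslot : ∀ o → slot (slotEdge o) (slotHalf o) ≡ o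
  slot-unslot o with splitAt (nE H) o in eq
  ... | inj₁ h = splitAt⁻¹-↑ˡ eq
  ... | inj₂ h = splitAt⁻¹-↑ʳ eq

  slot-injective : ∀ {h c h′ c′} → slot h c ≡ slot h′ c′ → h ≡ h′ × c ≡ c′
  slot-injective {h} {c} {h′} {c′} eq with trans (sym (unslot-slot h c)) (trans (cong unslot eq) (unslot-slot h′ c′))
  ... | refl = refl , refl

  b2n-slot-== : ∀ h c h′ c′ → b2n (slot h c == slot h′ c′) ≡ b2n ((h == h′) ∧ (c ==ᴮ c′))
  b2n-slot-== h c h′ c′ with ==-view (slot h c) (slot h′ c′)
  ... | equal same s=s with slot-injective {h} {c} {h′} {c′} same
  ...   | refl , refl rewrite s=s | ==-refl h | ==ᴮ-refl c = refl
  b2n-slot-== h c h′ c′ | distinct differ s=s rewrite s=s with h == h′ in h=h′ | c ==ᴮ c′ in c=c′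
  ...   | true  | true  = contradiction (cong₂ slot (==⇒≡ h=h′) (==ᴮ⇒≡ {c} {c′} c=c′)) differ
  ...   | true  | false = refl
  ...   | false | _     = refl

  sumFin-slots : (F : Fin nSlots → ℕ) → sumFin nSlots F ≡ sumFin (nE H) (λ h → F (slot h false) + F (slot h true))
  sumFin-slots F = trans (sumFin-++ (nE H) (nE H) F) (sym (sumFin-+ (nE H) (λ h → F (slot h false)) (λ h → F (slot h true))))

  Key : Set
  Key = ℕ × SlotKey (nV H)

  infix 5 _==ᴷ_
  _==ᴷ_ : Key → Key → Bool
  (α , s) ==ᴷ (β , u) = (α ≡ᵇ β) ∧ (s ==ᵏ u)

  ==ᴷ-refl : ∀ k → k ==ᴷ k ≡ true
  ==ᴷ-refl (α , s) = cong₂ _∧_ (≡ᵇ-refl α) (==ᵏ-refl s)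

  ==ᴷ-sym : ∀ k l → k ==ᴷ l ≡ l ==ᴷ k
  ==ᴷ-sym (α , s) (β , u) = cong₂ _∧_ (≡ᵇ-sym α β) (==ᵏ-sym s u)

  ==ᴷ⇒ : ∀ {α β s u} → (α , s) ==ᴷ (β , u) ≡ true → α ≡ β × s ==ᵏ u ≡ true
  ==ᴷ⇒ {α} e with ∧-true {α ≡ᵇ _} e
  ... | α=β , s=u = ≡ᵇ-true α=β , s=u

  ==ᴷ-trans : ∀ k l j → k ==ᴷ l ≡ true → l ==ᴷ j ≡ true → k ==ᴷ j ≡ true
  ==ᴷ-trans (α , s) (β , u) (γ , w) e₁ e₂ with ==ᴷ⇒ {α} {β} {s} {u} e₁ | ==ᴷ⇒ {β} {γ} {u} {w} e₂
  ... | refl , s=u | refl , u=w = cong₂ _∧_ (≡ᵇ-refl α) (==ᵏ-trans s u w s=u u=w)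

  edgeKey : Fin (nE H) → Key
  edgeKey h = ecol H h , keyOf halves (shape H h)

  slotKey : Fin nSlots → Key
  slotKey o = edgeKey (slotEdge o)

  slotExists : Fin (nE H) → Bool → Bool
  slotExists h c = if c then isULoop (shape H h) ∧ halves else true

  validSlot : Fin nSlots → Bool
  validSlot o = slotExists (slotEdge o) (slotHalf o)

  slotKey-slot : ∀ h c → slotKey (slot h c) ≡ edgeKey h
  slotKey-slot h c = cong (λ p → edgeKey (proj₁ p)) (unslot-slot h c)

  validSlot-slot : ∀ h c → validSlot (slot h c) ≡ slotExists h c
  validSlot-slot h c = cong (λ p → slotExists (proj₁ p) (proj₂ p)) (unslot-slot h c)

  moveKey : Key → Key
  moveKey (α , s) = α , mapKey σ s

  ==ᴷ-moveKey : ∀ k l → moveKey k ==ᴷ moveKey l ≡ k ==ᴷ l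
  ==ᴷ-moveKey (α , s) (β , u) = cong ((α ≡ᵇ β) ∧_) (==ᵏ-mapKey σ σ-involutive s u)

  open RankMatching _==ᴷ_ ==ᴷ-refl ==ᴷ-sym ==ᴷ-trans slotKey validSlot moveKey ==ᴷ-moveKey public

  multiplicity-slotsKeyed : ∀ α u →
    multiplicity (α , u) ≡ sumFin (nE H) (λ h → if ecol H h ≡ᵇ α then slotsKeyed halves u (shape H h) else 0)
  multiplicity-slotsKeyed α u = trans (sumFin-slots _) (sumFin-cong (nE H) per-edge)
    where
    two-slots : ∀ c v E → b2n (true ∧ (c ∧ E)) + b2n (v ∧ (c ∧ E)) ≡ (if c then (1 + b2n v) * b2n E else 0)
    two-slots true  true  E = cong (b2n E +_) (sym (+-identityʳ _))
    two-slots true  false E = refl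
    two-slots false true  E = refl
    two-slots false false E = refl
    per-edge : ∀ h → b2n (HasKey (α , u) (slot h false)) + b2n (HasKey (α , u) (slot h true))
                     ≡ (if ecol H h ≡ᵇ α then slotsKeyed halves u (shape H h) else 0)
    per-edge h = trans (cong₂ _+_ (cong₂ (λ v k → b2n (v ∧ (k ==ᴷ (α , u)))) (validSlot-slot h false) (slotKey-slot h false))
                                  (cong₂ (λ v k → b2n (v ∧ (k ==ᴷ (α , u)))) (validSlot-slot h true) (slotKey-slot h true)))
                       (two-slots (ecol H h ≡ᵇ α) (isULoop (shape H h) ∧ halves) (keyOf halves (shape H h) ==ᵏ u))

  private
    multiplicity-via : ∀ α u (g : Shape (Fin (nV H)) → ℕ) → (∀ s → Normal s → slotsKeyed halves u s ≡ g s) →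
      multiplicity (α , u) ≡ sumFin (nE H) (λ h → if ecol H h ≡ᵇ α then g (shape H h) else 0)
    multiplicity-via α u g eq =
      trans (multiplicity-slotsKeyed α u) (sumFin-cong (nE H) (λ h → if-then-0-cong (ecol H h ≡ᵇ α) (eq (shape H h) (wf H h))))

  multiplicity-undir : ∀ a b → a ≢ b → ∀ α → multiplicity (α , undirK a b) ≡ mult U a b α
  multiplicity-undir a b a≢b α = multiplicity-via α _ _ (slotsKeyed-undir halves a≢b)

  multiplicity-dir : ∀ a b → a ≢ b → ∀ α → multiplicity (α , dirK a b) ≡ mult O a b α
  multiplicity-dir a b a≢b α = multiplicity-via α _ _ (λ s _ → slotsKeyed-dir halves a≢b s)

  multiplicity-dloop : ∀ a α → multiplicity (α , dloopK a) ≡ mult O a a α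
  multiplicity-dloop a α = multiplicity-via α _ _ (slotsKeyed-dloop halves a)

  multiplicity-half : halves ≡ true → ∀ a α → multiplicity (α , halfK a) ≡ mult U a a α
  multiplicity-half refl a α = multiplicity-via α _ _ (slotsKeyed-half a)

  uloopCount : Fin (nV H) → ℕ → ℕ
  uloopCount a α = sumFin (nE H) (λ h → if ecol H h ≡ᵇ α then uloopAt a (shape H h) else 0)

  multiplicity-uloop : halves ≡ false → ∀ a α → multiplicity (α , uloopK a) ≡ uloopCount a α
  multiplicity-uloop refl a α = multiplicity-via α _ _ (λ s _ → slotsKeyed-uloop a s)

  multiplicity-semi : halves ≡ false → ∀ a α → multiplicity (α , semiK a) ≡ semiCount H a α
  multiplicity-semi refl a α = multiplicity-via α _ _ (λ s _ → slotsKeyed-semi a s)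

  mult-self : ∀ a α → mult U a a α ≡ 2 * uloopCount a α + semiCount H a α
  mult-self a α = trans (sumFin-cong (nE H) per-edge) (trans (sumFin-+ (nE H) _ _) (cong (_+ semiCount H a α) (sumFin-*ˡ (nE H) 2 _)))
    where
    per-edge : ∀ h → (if ecol H h ≡ᵇ α then into U a (_== a) (shape H h) else 0)
                     ≡ 2 * (if ecol H h ≡ᵇ α then uloopAt a (shape H h) else 0)
                       + (if ecol H h ≡ᵇ α then isSemiAt a (shape H h) else 0)
    per-edge h = trans (if-then-0-cong (ecol H h ≡ᵇ α) (into-self a (shape H h) (wf H h)))
                       (trans (if-then-0-+ (ecol H h ≡ᵇ α) _ _)
                              (cong (_+ (if ecol H h ≡ᵇ α then isSemiAt a (shape H h) else 0))
                                    (if-then-0-* (ecol H h ≡ᵇ α) 2 (uloopAt a (shape H h)))))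

  semiCount-σ : halves ≡ false → ∀ a α → semiCount H a α ≡ semiCount H (σ a) α
  semiCount-σ unhalved a α with blockView a
  ... | singleton σa≡a _ = cong (λ z → semiCount H z α) (sym σa≡a)
  ... | doublet (σa≢a , c) = semis-balanced unhalved a (σ a) (sym c) (λ a≡σa → σa≢a (sym a≡σa)) α

  -- mult U a a counts loops and semi-edges together; the semi-edge hypothesis separates them
  uloopCount-σ : halves ≡ false → ∀ a α → uloopCount a α ≡ uloopCount (σ a) α
  uloopCount-σ unhalved a α = *-cancelˡ-≡ _ _ 2 (+-cancelʳ-≡ (semiCount H a α) _ _ (begin
    2 * uloopCount a α + semiCount H a α             ≡⟨ mult-self a α ⟨
    mult U a a α                                     ≡⟨ mult-σ U a a α ⟩
    mult U (σ a) (σ a) α                             ≡⟨ mult-self (σ a) α ⟩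
    2 * uloopCount (σ a) α + semiCount H (σ a) α     ≡⟨ cong (2 * uloopCount (σ a) α +_) (semiCount-σ unhalved a α) ⟨
    2 * uloopCount (σ a) α + semiCount H a α ∎))
    where open ≡-Reasoning

  on-halves : (P : Bool → Set) → (halves ≡ true → P true) → (halves ≡ false → P false) → P halves
  on-halves P if-true if-false = by-cases halves refl
    where
    by-cases : ∀ b → halves ≡ b → P halves
    by-cases true  e = subst P (sym e) (if-true e)
    by-cases false e = subst P (sym e) (if-false e)

  multiplicity-moved : ∀ α (s : Shape (Fin (nV H))) → Normal s →
    multiplicity (α , keyOf halves s) ≡ multiplicity (α , mapKey σ (keyOf halves s))
  multiplicity-moved α (undir a b) a≢b = begin
    multiplicity (α , undirK a b)             ≡⟨ multiplicity-undir a b a≢b α ⟩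
    mult U a b α                              ≡⟨ mult-σ U a b α ⟩
    mult U (σ a) (σ b) α                      ≡⟨ multiplicity-undir (σ a) (σ b) (λ eq → a≢b (σ-injective eq)) α ⟨
    multiplicity (α , undirK (σ a) (σ b)) ∎
    where open ≡-Reasoning
  multiplicity-moved α (dir a b) a≢b = begin
    multiplicity (α , dirK a b)               ≡⟨ multiplicity-dir a b a≢b α ⟩
    mult O a b α                              ≡⟨ mult-σ O a b α ⟩
    mult O (σ a) (σ b) α                      ≡⟨ multiplicity-dir (σ a) (σ b) (λ eq → a≢b (σ-injective eq)) α ⟨
    multiplicity (α , dirK (σ a) (σ b)) ∎
    where open ≡-Reasoning
  multiplicity-moved α (dloop a) _ =
    trans (multiplicity-dloop a α) (trans (mult-σ O a a α) (sym (multiplicity-dloop (σ a) α)))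
  multiplicity-moved α (uloop a) _ =
    on-halves (λ b → multiplicity (α , keyOf b (uloop a)) ≡ multiplicity (α , mapKey σ (keyOf b (uloop a))))
      (λ halved → trans (multiplicity-half halved a α) (trans (mult-σ U a a α) (sym (multiplicity-half halved (σ a) α))))
      (λ unhalved → trans (multiplicity-uloop unhalved a α)
                          (trans (uloopCount-σ unhalved a α) (sym (multiplicity-uloop unhalved (σ a) α))))
  multiplicity-moved α (semi a) _ =
    on-halves (λ b → multiplicity (α , keyOf b (semi a)) ≡ multiplicity (α , mapKey σ (keyOf b (semi a))))
      (λ halved → trans (multiplicity-half halved a α) (trans (mult-σ U a a α) (sym (multiplicity-half halved (σ a) α))))
      (λ unhalved → trans (multiplicity-semi unhalved a α)
                          (trans (semiCount-σ unhalved a α) (sym (multiplicity-semi unhalved (σ a) α))))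

  multiplicity-moveKey : ∀ o → validSlot o ≡ true → multiplicity (slotKey o) ≡ multiplicity (moveKey (slotKey o))
  multiplicity-moveKey o _ = multiplicity-moved (ecol H (slotEdge o)) (shape H (slotEdge o)) (wf H (slotEdge o))

  open Matched multiplicity-moveKey public

  keyAt : Fin nSlots → SlotKey (nV H)
  keyAt o = keyOf halves (shape H (slotEdge o))

  slots-of-edge : ∀ k w h′ →
    sumFin nSlots (λ o → b2n (slotEdge o == h′) * (b2n (validSlot o) * slotInc k w (keyAt o))) ≡ into k w allV (shape H h′)
  slots-of-edge k w h′ = begin
    sumFin nSlots F
      ≡⟨ sumFin-slots F ⟩
    sumFin (nE H) (λ h → F (slot h false) + F (slot h true))
      ≡⟨ sumFin-cong (nE H) (λ h → trans (cong₂ _+_ (F-slot h false) (F-slot h true)) (sym (*-distribˡ-+ (b2n (h == h′)) _ _))) ⟩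
    sumFin (nE H) (λ h → b2n (h == h′) * (A h false + A h true))
      ≡⟨ sumFin-δ (nE H) h′ (λ h → A h false + A h true) ⟩
    A h′ false + A h′ true
      ≡⟨ cong (_+ A h′ true) (*-identityˡ _) ⟩
    slots halves (shape H h′) * slotInc k w (keyOf halves (shape H h′))
      ≡⟨ into-slots halves k w (shape H h′) ⟨
    into k w allV (shape H h′) ∎
    where
    open ≡-Reasoning
    F : Fin nSlots → ℕ
    F o = b2n (slotEdge o == h′) * (b2n (validSlot o) * slotInc k w (keyAt o))
    A : Fin (nE H) → Bool → ℕ
    A h c = b2n (slotExists h c) * slotInc k w (keyOf halves (shape H h))
    F-slot : ∀ h c → F (slot h c) ≡ b2n (h == h′) * A h c
    F-slot h c = cong (λ p → b2n (proj₁ p == h′) * A (proj₁ p) (proj₂ p)) (unslot-slot h c)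

module Reassignment (G H : Graph) {t : ℕ} (cls : Fin (nV H) → Fin t)
  (fibres≤2 : (u v w : Fin (nV H)) → cls u ≡ cls v → cls v ≡ cls w → u ≡ v ⊎ (v ≡ w ⊎ u ≡ w))
  (equitable : Equitable H cls)
  (fV : Fin (nV G) → Fin (nV H)) (fE : Fin (nE G) → Fin (nE H)) (covering : IsCovering G H fV fE)
  (halves : Bool) (colour : Fin (nE G) → Bool)
  (balanced : halves ≡ true → ∀ x h a₀ → shape H h ≡ uloop a₀ → fV x ≡ a₀ → ∀ c →
     sumFin (nE G) (λ e′ → b2n ((fE e′ == h) ∧ (colour e′ ==ᴮ c)) * into U x allV (shape G e′)) ≡ 1)
  (links : halves ≡ true → ∀ e → Link (shape G e))
  (semis-balanced : halves ≡ false → ∀ r g → cls r ≡ cls g → r ≢ g → ∀ α → semiCount H r α ≡ semiCount H g α)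
  (f′ : Fin (nV G) → Fin (nV H))
  (f′≡σfV : ∀ x → f′ x ≡ BlockSwap.σ cls fibres≤2 (fV x))
  where

  open SlotMatching H cls fibres≤2 equitable halves semis-balanced

  private
    nG : ℕ
    nG = nE G

    vcol-fV : ∀ x → vcol H (fV x) ≡ vcol G x
    vcol-fV = proj₁ covering

    ecol-fE : ∀ e → ecol H (fE e) ≡ ecol G e
    ecol-fE = proj₁ (proj₂ covering)

    over : ∀ e → ShapeOver fV (shape G e) (shape H (fE e))
    over = proj₁ (proj₂ (proj₂ covering))

    local : ∀ x h k → sumFin nG (λ e′ → if fE e′ == h then into k x allV (shape G e′) else 0)
                        ≡ into k (fV x) allV (shape H h)
    local = proj₁ (proj₂ (proj₂ (proj₂ covering)))

    fibres : ∀ u v → fibre G H fV u ≡ fibre G H fV v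
    fibres = proj₂ (proj₂ (proj₂ (proj₂ covering)))

    uloop-shape : (s : Shape (Fin (nV H))) → isULoop s ≡ true → ∃ λ a → s ≡ uloop a
    uloop-shape (uloop a) _ = a , refl

  ι : Kind → Fin (nV G) → Fin nG → ℕ
  ι k x e′ = into k x allV (shape G e′)

  halved : Fin (nE H) → Bool
  halved h = isULoop (shape H h) ∧ halves

  -- over a halved loop, the colour of e′ chooses the half
  slotOf : Fin nG → Fin nSlots
  slotOf e′ = slot (fE e′) (halved (fE e′) ∧ colour e′)

  fE′ : Fin nG → Fin (nE H)
  fE′ e′ = slotEdge (π (slotOf e′))

  local-sum : ∀ x h k → sumFin nG (λ e′ → b2n (fE e′ == h) * ι k x e′) ≡ into k (fV x) allV (shape H h)
  local-sum x h k = trans (sumFin-cong nG (λ e′ → sym (if-then-0 (fE e′ == h) (ι k x e′)))) (local x h k)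

  slotOf-== : ∀ e′ h c → b2n (slotOf e′ == slot h c) ≡ b2n ((fE e′ == h) ∧ ((halved h ∧ colour e′) ==ᴮ c))
  slotOf-== e′ h c with ==-view (fE e′) h
  ... | equal refl _ = b2n-slot-== (fE e′) (halved (fE e′) ∧ colour e′) h c
  ... | distinct _ fE≠h = trans (b2n-slot-== (fE e′) (halved (fE e′) ∧ colour e′) h c)
         (trans (cong (λ b → b2n (b ∧ ((halved (fE e′) ∧ colour e′) ==ᴮ c))) fE≠h)
                (sym (cong (λ b → b2n (b ∧ ((halved h ∧ colour e′) ==ᴮ c))) fE≠h)))

  assigned-unhalved : ∀ x k h c → halved h ≡ false →
    sumFin nG (λ e′ → b2n (slotOf e′ == slot h c) * ι k x e′)
      ≡ b2n (slotExists h c) * slotInc k (fV x) (keyOf halves (shape H h))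
  assigned-unhalved x k h c unhalved = begin
    sumFin nG (λ e′ → b2n (slotOf e′ == slot h c) * ι k x e′)        ≡⟨ sumFin-cong nG pointwise ⟩
    sumFin nG (λ e′ → b2n (false ==ᴮ c) * (b2n (fE e′ == h) * ι k x e′)) ≡⟨ sumFin-*ˡ nG (b2n (false ==ᴮ c)) _ ⟩
    b2n (false ==ᴮ c) * sumFin nG (λ e′ → b2n (fE e′ == h) * ι k x e′) ≡⟨ cong (b2n (false ==ᴮ c) *_) (local-sum x h k) ⟩
    b2n (false ==ᴮ c) * into k (fV x) allV (shape H h)               ≡⟨ only-first-slot c ⟩
    b2n (slotExists h c) * slotInc k (fV x) (keyOf halves (shape H h)) ∎
    where
    open ≡-Reasoning
    pointwise : ∀ e′ → b2n (slotOf e′ == slot h c) * ι k x e′ ≡ b2n (false ==ᴮ c) * (b2n (fE e′ == h) * ι k x e′)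
    pointwise e′ = begin
      b2n (slotOf e′ == slot h c) * ι k x e′                           ≡⟨ cong (_* ι k x e′) (slotOf-== e′ h c) ⟩
      b2n ((fE e′ == h) ∧ ((halved h ∧ colour e′) ==ᴮ c)) * ι k x e′   ≡⟨ cong (λ b → b2n ((fE e′ == h) ∧ ((b ∧ colour e′) ==ᴮ c)) * ι k x e′) unhalved ⟩
      b2n ((fE e′ == h) ∧ (false ==ᴮ c)) * ι k x e′                    ≡⟨ cong (_* ι k x e′) (b2n-∧ (fE e′ == h) (false ==ᴮ c)) ⟩
      b2n (fE e′ == h) * b2n (false ==ᴮ c) * ι k x e′                  ≡⟨ *-CS.xy∙z≈y∙xz (b2n (fE e′ == h)) (b2n (false ==ᴮ c)) (ι k x e′) ⟩
      b2n (false ==ᴮ c) * (b2n (fE e′ == h) * ι k x e′) ∎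
    single-slot : into k (fV x) allV (shape H h) ≡ slotInc k (fV x) (keyOf halves (shape H h))
    single-slot = trans (into-slots halves k (fV x) (shape H h))
                        (trans (cong (λ b → (1 + b2n b) * slotInc k (fV x) (keyOf halves (shape H h))) unhalved)
                               (*-identityˡ _))
    only-first-slot : ∀ c → b2n (false ==ᴮ c) * into k (fV x) allV (shape H h)
                            ≡ b2n (slotExists h c) * slotInc k (fV x) (keyOf halves (shape H h))
    only-first-slot false = trans (*-identityˡ _) (trans single-slot (sym (*-identityˡ _)))
    only-first-slot true  = cong (λ b → b2n b * slotInc k (fV x) (keyOf halves (shape H h))) (sym unhalved)

  coloured : Kind → Fin (nV G) → Fin (nE H) → Bool → ℕ
  coloured k x h c = sumFin nG (λ e′ → b2n ((fE e′ == h) ∧ (colour e′ ==ᴮ c)) * ι k x e′)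

  coloured-U : halves ≡ true → ∀ x h a₀ c → shape H h ≡ uloop a₀ → coloured U x h c ≡ b2n (a₀ == fV x)
  coloured-U halved x h a₀ c sh with ==-view (fV x) a₀
  ... | equal fx≡a₀ _ = trans (balanced halved x h a₀ sh fx≡a₀ c) (cong b2n (sym (trans (cong (a₀ ==_) fx≡a₀) (==-refl a₀))))
  ... | distinct fx≢a₀ _ = trans (n≤0⇒n≡0 (≤-trans (sumFin-mono-≤ nG (λ e′ → *-monoˡ-≤ (ι U x e′) (b2n-∧-≤ (fE e′ == h) _)))
                                                 (≤-reflexive (trans (local-sum x h U) no-loop-at-fx))))
                                 (cong b2n (sym a₀≠fx))
    where
    a₀≠fx : (a₀ == fV x) ≡ false
    a₀≠fx = ≢⇒==false (λ a₀≡fx → fx≢a₀ (sym a₀≡fx))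
    no-loop-at-fx : into U (fV x) allV (shape H h) ≡ 0
    no-loop-at-fx rewrite sh | a₀≠fx = refl

  into-directed-over-uloop : ∀ {x : Fin (nV G)} {a : Fin (nV H)} (k : Kind) → k ≢ U →
    (sg : Shape (Fin (nV G))) → ShapeOver fV sg (uloop a) → into k x allV sg ≡ 0
  into-directed-over-uloop U k≢U _ _ = contradiction refl k≢U
  into-directed-over-uloop O _ (undir _ _) _ = refl
  into-directed-over-uloop O _ (uloop _)   _ = refl
  into-directed-over-uloop I _ (undir _ _) _ = refl
  into-directed-over-uloop I _ (uloop _)   _ = refl

  coloured-directed : ∀ k → k ≢ U → ∀ x h a₀ c → shape H h ≡ uloop a₀ → coloured k x h c ≡ 0
  coloured-directed k k≢U x h a₀ c sh = sumFin-zero nG _ term-0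
    where
    term-0 : ∀ e′ → b2n ((fE e′ == h) ∧ (colour e′ ==ᴮ c)) * ι k x e′ ≡ 0
    term-0 e′ with ==-view (fE e′) h
    ... | distinct _ fE≠h rewrite fE≠h = refl
    ... | equal refl _ = trans (cong (b2n ((fE e′ == h) ∧ (colour e′ ==ᴮ c)) *_) (into-directed-over-uloop {x} k k≢U (shape G e′) over-a₀))
                               (*-zeroʳ (b2n ((fE e′ == h) ∧ (colour e′ ==ᴮ c))))
      where
      over-a₀ : ShapeOver fV (shape G e′) (uloop a₀)
      over-a₀ = subst (ShapeOver fV (shape G e′)) sh (over e′)

  assigned-halved : ∀ x k h c → halved h ≡ true →
    sumFin nG (λ e′ → b2n (slotOf e′ == slot h c) * ι k x e′)
      ≡ b2n (slotExists h c) * slotInc k (fV x) (keyOf halves (shape H h))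
  assigned-halved x k h c halved-h with ∧-true {isULoop (shape H h)} halved-h
  ... | is-loop , halving with uloop-shape (shape H h) is-loop
  ...   | a₀ , sh = begin
    sumFin nG (λ e′ → b2n (slotOf e′ == slot h c) * ι k x e′)   ≡⟨ sumFin-cong nG pointwise ⟩
    coloured k x h c                                              ≡⟨ coloured-kind k ⟩
    slotInc k (fV x) (halfK a₀)                                   ≡⟨ *-identityˡ _ ⟨
    1 * slotInc k (fV x) (halfK a₀)                               ≡⟨ cong₂ (λ b key → b2n b * slotInc k (fV x) key) (sym (exists c)) (sym key-half) ⟩
    b2n (slotExists h c) * slotInc k (fV x) (keyOf halves (shape H h)) ∎
    where
    open ≡-Reasoning
    pointwise : ∀ e′ → b2n (slotOf e′ == slot h c) * ι k x e′ ≡ b2n ((fE e′ == h) ∧ (colour e′ ==ᴮ c)) * ι k x e′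
    pointwise e′ = trans (cong (_* ι k x e′) (slotOf-== e′ h c))
                         (cong (λ b → b2n ((fE e′ == h) ∧ ((b ∧ colour e′) ==ᴮ c)) * ι k x e′) halved-h)
    exists : ∀ c → slotExists h c ≡ true
    exists false = refl
    exists true  = halved-h
    key-half : keyOf halves (shape H h) ≡ halfK a₀
    key-half = cong₂ keyOf halving sh
    coloured-kind : ∀ k → coloured k x h c ≡ slotInc k (fV x) (halfK a₀)
    coloured-kind U = coloured-U halving x h a₀ c sh
    coloured-kind O = coloured-directed O (λ ()) x h a₀ c sh
    coloured-kind I = coloured-directed I (λ ()) x h a₀ c sh

  assigned : ∀ x k o → sumFin nG (λ e′ → b2n (slotOf e′ == o) * ι k x e′) ≡ b2n (validSlot o) * slotInc k (fV x) (keyAt o)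
  assigned x k o = trans (cong (λ o′ → sumFin nG (λ e′ → b2n (slotOf e′ == o′) * ι k x e′)) (sym (slot-unslot o)))
                         (by-halving (halved (slotEdge o)) refl)
    where
    by-halving : ∀ b → halved (slotEdge o) ≡ b →
      sumFin nG (λ e′ → b2n (slotOf e′ == slot (slotEdge o) (slotHalf o)) * ι k x e′)
        ≡ b2n (validSlot o) * slotInc k (fV x) (keyAt o)
    by-halving false unhalved = assigned-unhalved x k (slotEdge o) (slotHalf o) unhalved
    by-halving true  halved-h = assigned-halved x k (slotEdge o) (slotHalf o) halved-h

  π-moves : ∀ o → validSlot o ≡ true → ecol H (slotEdge (π o)) ≡ ecol H (slotEdge o) × keyAt (π o) ≈ᵏ mapKey σ (keyAt o)
  π-moves o valid with ==ᴷ⇒ {ecol H (slotEdge (π o))} {ecol H (slotEdge o)} {keyAt (π o)} {mapKey σ (keyAt o)} (π-key o valid)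
  ... | same-colour , moved = same-colour , ==ᵏ⇒≈ᵏ _ _ moved

  transfer : ∀ x k o → b2n (validSlot o) * slotInc k (fV x) (keyAt o)
                       ≡ b2n (validSlot (π o)) * slotInc k (σ (fV x)) (keyAt (π o))
  transfer x k o = by-validity (validSlot o) refl
    where
    by-validity : ∀ b → validSlot o ≡ b → b2n (validSlot o) * slotInc k (fV x) (keyAt o)
                                          ≡ b2n (validSlot (π o)) * slotInc k (σ (fV x)) (keyAt (π o))
    before : ∀ {b} → validSlot o ≡ b → b2n (validSlot o) * slotInc k (fV x) (keyAt o) ≡ b2n b * slotInc k (fV x) (keyAt o)
    before = cong (λ b → b2n b * slotInc k (fV x) (keyAt o))
    after : ∀ {b} → validSlot o ≡ b →
            b2n (validSlot (π o)) * slotInc k (σ (fV x)) (keyAt (π o)) ≡ b2n b * slotInc k (σ (fV x)) (keyAt (π o))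
    after v = cong (λ b → b2n b * slotInc k (σ (fV x)) (keyAt (π o))) (trans (π-valid o) v)
    by-validity false invalid = trans (before invalid) (sym (after invalid))
    by-validity true  valid   = trans (before valid) (trans (cong (_+ 0) moved-incidence) (sym (after valid)))
      where
      moved-incidence : slotInc k (fV x) (keyAt o) ≡ slotInc k (σ (fV x)) (keyAt (π o))
      moved-incidence = trans (sym (slotInc-mapKey σ σ-injective k (fV x) (keyAt o)))
                              (slotInc-≈ᵏ k (σ (fV x)) (≈ᵏ-sym (proj₂ (π-moves o valid))))

  slotOf-valid : ∀ e′ → validSlot (slotOf e′) ≡ true
  slotOf-valid e′ = trans (validSlot-slot (fE e′) (halved (fE e′) ∧ colour e′))
                          (second-only-if-halved (halved (fE e′)) (colour e′))
    where
    second-only-if-halved : ∀ u c → (if u ∧ c then u else true) ≡ true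
    second-only-if-halved true  true  = refl
    second-only-if-halved true  false = refl
    second-only-if-halved false c     = refl

  π-moves-slotOf : ∀ e′ → ecol H (fE′ e′) ≡ ecol H (fE e′) ×
                          keyAt (π (slotOf e′)) ≈ᵏ mapKey σ (keyOf halves (shape H (fE e′)))
  π-moves-slotOf e′ = subst (λ h → ecol H (fE′ e′) ≡ ecol H h ×
                                  keyAt (π (slotOf e′)) ≈ᵏ mapKey σ (keyOf halves (shape H h)))
                            (cong proj₁ (unslot-slot (fE e′) (halved (fE e′) ∧ colour e′)))
                            (π-moves (slotOf e′) (slotOf-valid e′))

  vcol-f′ : ∀ x → vcol H (f′ x) ≡ vcol G x
  vcol-f′ x = begin
    vcol H (f′ x)          ≡⟨ cong (vcol H) (f′≡σfV x) ⟩
    vcol H (σ (fV x))      ≡⟨ proj₁ (equitable (fV x) (σ (fV x)) (sym (σ-cls (fV x)))) ⟨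
    vcol H (fV x)          ≡⟨ vcol-fV x ⟩
    vcol G x ∎
    where open ≡-Reasoning

  ecol-fE′ : ∀ e′ → ecol H (fE′ e′) ≡ ecol G e′
  ecol-fE′ e′ = trans (proj₁ (π-moves-slotOf e′)) (ecol-fE e′)

  over-fE′ : ∀ e′ → ShapeOver f′ (shape G e′) (shape H (fE′ e′))
  over-fE′ e′ = ShapeOver-moved σ f′≡σfV halves (shape G e′) (shape H (fE e′)) (shape H (fE′ e′)) (over e′)
                  (moved-from-key halves σ (shape H (fE e′)) (shape H (fE′ e′)) (proj₂ (π-moves-slotOf e′)))
                  (λ halved → links halved e′)

  fibre-f′ : ∀ u → fibre G H f′ u ≡ fibre G H fV (σ u)
  fibre-f′ u = sumFin-cong (nV G) (λ x → cong b2n (begin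
    f′ x == u                  ≡⟨ cong (_== u) (f′≡σfV x) ⟩
    σ (fV x) == u              ≡⟨ cong (σ (fV x) ==_) (σ-involutive u) ⟨
    σ (fV x) == σ (σ u)        ≡⟨ ==-injective σ σ-injective (fV x) (σ u) ⟩
    fV x == σ u ∎))
    where open ≡-Reasoning

  fibres-f′ : ∀ u v → fibre G H f′ u ≡ fibre G H f′ v
  fibres-f′ u v = trans (fibre-f′ u) (trans (fibres (σ u) (σ v)) (sym (fibre-f′ v)))

  local-fE′ : ∀ x h′ k → sumFin nG (λ e′ → if fE′ e′ == h′ then ι k x e′ else 0) ≡ into k (f′ x) allV (shape H h′)
  local-fE′ x h′ k = begin
    sumFin nG (λ e′ → if fE′ e′ == h′ then ι k x e′ else 0)
      ≡⟨ sumFin-cong nG (λ e′ → if-then-0 (fE′ e′ == h′) (ι k x e′)) ⟩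
    sumFin nG (λ e′ → b2n (fE′ e′ == h′) * ι k x e′)
      ≡⟨ sumFin-cong nG (λ e′ → sym (sumFin-δ′ nSlots (slotOf e′) (λ o → b2n (slotEdge (π o) == h′) * ι k x e′))) ⟩
    sumFin nG (λ e′ → sumFin nSlots (λ o → b2n (slotOf e′ == o) * (b2n (slotEdge (π o) == h′) * ι k x e′)))
      ≡⟨ sumFin-swap nG nSlots _ ⟩
    sumFin nSlots (λ o → sumFin nG (λ e′ → b2n (slotOf e′ == o) * (b2n (slotEdge (π o) == h′) * ι k x e′)))
      ≡⟨ sumFin-cong nSlots (λ o → trans (sumFin-cong nG (λ e′ → *-CS.x∙yz≈y∙xz (b2n (slotOf e′ == o)) (b2n (slotEdge (π o) == h′)) (ι k x e′)))
                                          (sumFin-*ˡ nG (b2n (slotEdge (π o) == h′)) _)) ⟩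
    sumFin nSlots (λ o → b2n (slotEdge (π o) == h′) * sumFin nG (λ e′ → b2n (slotOf e′ == o) * ι k x e′))
      ≡⟨ sumFin-cong nSlots (λ o → cong (b2n (slotEdge (π o) == h′) *_) (trans (assigned x k o) (transfer x k o))) ⟩
    sumFin nSlots (λ o → slotsAt (π o))
      ≡⟨ sumFin-reindex nSlots π π-injective slotsAt ⟩
    sumFin nSlots slotsAt
      ≡⟨ slots-of-edge k (σ (fV x)) h′ ⟩
    into k (σ (fV x)) allV (shape H h′)
      ≡⟨ cong (λ v → into k v allV (shape H h′)) (f′≡σfV x) ⟨
    into k (f′ x) allV (shape H h′) ∎
    where
    open ≡-Reasoning
    slotsAt : Fin nSlots → ℕ
    slotsAt o = b2n (slotEdge o == h′) * (b2n (validSlot o) * slotInc k (σ (fV x)) (keyAt o))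

  reassigned : IsCovering G H f′ fE′
  reassigned = vcol-f′ , ecol-fE′ , over-fE′ , local-fE′ , fibres-f′

crossing⇒Link : {n : ℕ} {side : Fin n → Bool} (s : Shape (Fin n)) → Crosses side s → Link s
crossing⇒Link (undir _ _) _ = tt
crossing⇒Link (dir _ _)   _ = tt

lemma16 : (G H : Graph) (t : ℕ)
          (clsG : Fin (nV G) → Fin t) (clsH : Fin (nV H) → Fin t) →
          IsDegreePartition H t clsH →
          IsDegreePartition G t clsG →
          ((u v w : Fin (nV H)) → clsH u ≡ clsH v → clsH v ≡ clsH w →
             (u ≡ v) ⊎ ((v ≡ w) ⊎ (u ≡ w))) →
          (fV : Fin (nV G) → Fin (nV H)) (fE : Fin (nE G) → Fin (nE H)) →
          IsCovering G H fV fE →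
          ((u : Fin (nV G)) → clsH (fV u) ≡ clsG u) →
          ((w : Fin (nV H)) → ∃ λ u → (clsG u ≡ clsH w) × (fV u ≡ w)) →
          (Bipartite G ⊎
            ((r g : Fin (nV H)) → clsH r ≡ clsH g → r ≢ g →
               (α : ℕ) → semiCount H r α ≡ semiCount H g α)) →
          (f' : Fin (nV G) → Fin (nV H)) →
          ((u : Fin (nV G)) → ((w : Fin (nV H)) → clsH w ≡ clsH (fV u) → w ≡ fV u) →
             f' u ≡ fV u) →
          ((u : Fin (nV G)) (w : Fin (nV H)) → clsH w ≡ clsH (fV u) → w ≢ fV u →
             f' u ≡ w) →
          ∃ λ (fE' : Fin (nE G) → Fin (nE H)) → IsCovering G H f' fE'
lemma16 G H t _ clsH degH _ fibres≤2 fV fE cov _ _ (inj₁ (side , cross)) f' alone paired = R.fE′ , R.reassigned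
  where
  open BlockSwap clsH fibres≤2 using (σ-unique)
  module C = LoopColouring G H fV fE (proj₁ (proj₂ (proj₂ cov)))
                          (λ x h → proj₁ (proj₂ (proj₂ (proj₂ cov))) x h U) side cross
  module R = Reassignment G H clsH fibres≤2 (proj₁ (proj₂ degH)) fV fE cov true C.loopColour
               (λ _ → C.loopColour-balanced) (λ _ e → crossing⇒Link (shape G e) (cross e)) (λ ())
               f' (λ x → σ-unique (fV x) (f' x) (alone x) (paired x))
lemma16 G H t _ clsH degH _ fibres≤2 fV fE cov _ _ (inj₂ semis-balanced) f' alone paired = R.fE′ , R.reassigned
  where
  open BlockSwap clsH fibres≤2 using (σ-unique)
  module R = Reassignment G H clsH fibres≤2 (proj₁ (proj₂ degH)) fV fE cov false (λ _ → false)
               (λ ()) (λ ()) (λ _ → semis-balanced)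
               f' (λ x → σ-unique (fV x) (f' x) (alone x) (paired x))
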